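{- Let $G$ be a 3-connected graph, and let $X$ be a set of three vertices of $G$ such that $G\setminus X$ has at least three components. Let $K$ be a component of $G\setminus X$, put $A:=V(K)\cup X$ and $B:=V(G\setminus K)$, and let $(A',B')$ be the reduction of the 3-separation $(A,B)$. Then: (1) $B'=B$ and $(A',B')\le(A,B)$; (2) $(A',B')$ is half-connected and strong; (3) if $(A',B')$ is nontrivial, then it is totally nested; (4) $(A',B')$ is nontrivial if and only if two vertices of $X$ are adjacent or $|K|\ge 2$.
   Context: Mixed-separation: ordered pair $(A,B)$ with $A\cup B=V(G)$, $A\setminus B,B\setminus A\neq\emptyset$; separator = disjoint union of $A\cap B$ and $E(A\setminus B,B\setminus A)$; mixed 3-separation if the separator has size three. $(A,B)\le(C,D)$ iff $A\subseteq C$ and $B\supseteq D$. Reduction of a mixed 3-separation $(X_1,X_2)$ of a 3-connected graph: for every vertex $v\in X_1\cap X_2$ having fewer than two neighbours in some side $X_i$ (this index is unique), delete $v$ from $X_i$; the resulting pair $(X_1',X_2')$ is the reduction (it is a tri-separation). Tri-separation: separator size three, every vertex of $A\cap B$ has at least two neighbours in $G[A]$ and $G[B]$; nontrivial if $G[A]$, $G[B]$ contain cycles; strong if every vertex of $A\cap B$ has degree at least four; half-connected if $G[A\setminus B]$ or $G[B\setminus A]$ is connected; totally nested if for every tri-separation $(C,D)$, after possibly swapping sides, $(A,B)\le(C,D)$. -}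

module Defs where

open import Data.Nat using (ℕ; zero; suc; _+_; _≤_; _<_; _<ᵇ_)
open import Data.Bool using (Bool; true; false; _∧_; _∨_; not; if_then_else_)
open import Data.Fin using (Fin; zero; suc; inject₁; fromℕ)
open import Data.Product using (Σ; ∃; _×_; _,_)
open import Data.Sum using (_⊎_)
open import Function.Definitions using (Injective)
open import Relation.Binary.PropositionalEquality using (_≡_; _≢_)
open import Relation.Nullary using (¬_)

record Graph : Set where
  field
    n     : ℕ
    adj   : Fin n → Fin n → Bool
    adj-sym : ∀ u v → adj u v ≡ adj v u
    adj-irr : ∀ v → adj v v ≡ false

count : {m : ℕ} → (Fin m → Bool) → ℕ
count {zero}  f = 0
count {suc m} f = (if f zero then 1 else 0) + count (λ i → f (suc i))

sumFin : {m : ℕ} → (Fin m → ℕ) → ℕ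
sumFin {zero}  f = 0
sumFin {suc m} f = f zero + sumFin (λ i → f (suc i))

module _ (G : Graph) where
  open Graph G

  VSet : Set
  VSet = Fin n → Bool

  _∈_ : Fin n → VSet → Set
  v ∈ S = S v ≡ true

  _∉_ : Fin n → VSet → Set
  v ∉ S = S v ≡ false

  _∩_ _∪_ _∖_ : VSet → VSet → VSet
  (S ∩ T) v = S v ∧ T v
  (S ∪ T) v = S v ∨ T v
  (S ∖ T) v = S v ∧ not (T v)

  ∁ : VSet → VSet
  ∁ S v = not (S v)

  _⊆_ : VSet → VSet → Set
  S ⊆ T = ∀ v → v ∈ S → v ∈ T

  _≐_ : VSet → VSet → Set
  S ≐ T = ∀ v → S v ≡ T v

  Nonempty : VSet → Set
  Nonempty S = ∃ λ v → v ∈ S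

  -- number of neighbours of v lying in S (= neighbours of v in G[S] when v ∈ S)
  nbrsIn : Fin n → VSet → ℕ
  nbrsIn v S = count (λ u → adj v u ∧ S u)

  degree : Fin n → ℕ
  degree v = count (adj v)

  data Reach (S : VSet) : Fin n → Fin n → Set where
    here : ∀ {u} → u ∈ S → Reach S u u
    step : ∀ {u w v} → u ∈ S → adj u w ≡ true → Reach S w v → Reach S u v

  Connected : VSet → Set
  Connected S = Nonempty S × (∀ u v → u ∈ S → v ∈ S → Reach S u v)

  HasCycle : VSet → Set
  HasCycle S = Σ ℕ λ m → Σ (Fin (suc (suc (suc m))) → Fin n) λ c →
      Injective _≡_ _≡_ c
    × (∀ i → c i ∈ S)
    × (∀ (i : Fin (suc (suc m))) → adj (c (inject₁ i)) (c (suc i)) ≡ true)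
    × (adj (c (fromℕ (suc (suc m)))) (c zero) ≡ true)

  ThreeConnected : Set
  ThreeConnected = 4 ≤ n × (∀ (Y : VSet) → count Y ≤ 2 → Connected (∁ Y))

  IsComponent : VSet → VSet → Set
  IsComponent X K =
      K ⊆ ∁ X
    × Connected K
    × (∀ u w → u ∈ K → adj u w ≡ true → w ∉ X → w ∈ K)

  AtLeastThreeComponents : VSet → Set
  AtLeastThreeComponents X = Σ VSet λ K₁ → Σ VSet λ K₂ → Σ VSet λ K₃ →
      IsComponent X K₁ × IsComponent X K₂ × IsComponent X K₃
    × ¬ (K₁ ≐ K₂) × ¬ (K₁ ≐ K₃) × ¬ (K₂ ≐ K₃)

  -- number of edges between A ∖ B and B ∖ A (ordered pairs (u,v) with
  -- u ∈ A∖B, v ∈ B∖A; since these sets are disjoint each edge counts once)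
  crossEdges : VSet → VSet → ℕ
  crossEdges A B = sumFin (λ u → if (A ∖ B) u then count (λ v → adj u v ∧ (B ∖ A) v) else 0)

  separatorSize : VSet → VSet → ℕ
  separatorSize A B = count (A ∩ B) + crossEdges A B

  IsMixedSeparation : VSet → VSet → Set
  IsMixedSeparation A B =
      (∀ v → v ∈ (A ∪ B)) × Nonempty (A ∖ B) × Nonempty (B ∖ A)

  IsMixed3Separation : VSet → VSet → Set
  IsMixed3Separation A B = IsMixedSeparation A B × separatorSize A B ≡ 3

  IsTriSeparation : VSet → VSet → Set
  IsTriSeparation A B = IsMixed3Separation A B
    × (∀ v → v ∈ (A ∩ B) → 2 ≤ nbrsIn v A × 2 ≤ nbrsIn v B)

  _≼_ : VSet × VSet → VSet × VSet → Set
  (A , B) ≼ (C , D) = A ⊆ C × D ⊆ B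

  Nontrivial : VSet → VSet → Set
  Nontrivial A B = HasCycle A × HasCycle B

  Strong : VSet → VSet → Set
  Strong A B = ∀ v → v ∈ (A ∩ B) → 4 ≤ degree v

  HalfConnected : VSet → VSet → Set
  HalfConnected A B = Connected (A ∖ B) ⊎ Connected (B ∖ A)

  TotallyNested : VSet → VSet → Set
  TotallyNested A B = ∀ C D → IsTriSeparation C D →
      ((A , B) ≼ (C , D)) ⊎ ((A , B) ≼ (D , C)) ⊎ ((B , A) ≼ (C , D)) ⊎ ((B , A) ≼ (D , C))

  lowIn : Fin n → VSet → VSet → Bool
  lowIn v X₁ X₂ = (X₁ ∩ X₂) v ∧ (nbrsIn v X₁ <ᵇ 2)

  reduction : VSet → VSet → VSet × VSet
  reduction X₁ X₂ = (λ v → X₁ v ∧ not (lowIn v X₁ X₂))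
                  , (λ v → X₂ v ∧ not (lowIn v X₂ X₁))

-- Every component of G − X other than K has a neighbour of each x ∈ X, since otherwise
-- deleting X − x would disconnect G. So every vertex of X keeps two neighbours in B and the
-- reduction only shrinks A, to K together with the vertices of X having two neighbours in A;
-- such a vertex also has a neighbour in each of two further components, hence degree four.
-- A cycle in A′ needs an edge inside X or two vertices of K. Conversely an edge inside X closes
-- up through K, and when |K| ≥ 2 the ends of a path of K extended as far as possible either
-- close a cycle in K or have two neighbours in X each, so they share one.
-- For a tri-separation (C , D), 3-connectivity lets a vertex of D ∖ C outside X reach the
-- separator while avoiding any two vertices. If X misses D ∖ C, every such vertex reaches all
-- (at most three) separator elements, which forces K or D ∖ (K ∪ X) to lie on one side. If X
-- meets both C ∖ D and D ∖ C, then, as |X| = 3, one of them in a single vertex y; now each of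
-- the three components owns one separator element, so D ∖ C = {y}, C ∩ D = ∅ and y ∉ A′.

module Submission where

open import Defs
open import Data.Nat using (ℕ; zero; suc; _+_; _≤_; _<_; z≤n; s≤s; _<ᵇ_; _≤?_)
open import Data.Nat.Properties
  using (≤-reflexive; ≤-trans; ≤-pred; n≤1+n; +-suc; +-identityʳ; +-mono-≤; <⇒≱; ≰⇒>; m≤n+m)
open import Data.Bool using (Bool; true; false; _∧_; _∨_; not; if_then_else_)
import Data.Bool as Bool
open import Data.Bool.Properties using (∧-identityʳ; ∧-zeroʳ; ∧-comm; ∨-comm)
open import Data.Fin as Fin using (Fin; zero; suc; inject₁; fromℕ)
open import Data.Fin.Properties using (_≟_; suc-injective; any?)
open import Data.Product using (Σ; ∃; ∃₂; _×_; _,_; proj₁; proj₂)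
open import Data.Product.Properties as Product using (,-injectiveˡ)
open import Data.Sum using (_⊎_; inj₁; inj₂; [_,_])
open import Data.Sum.Properties as Sum using (inj₁-injective; inj₂-injective)
open import Data.Empty using (⊥; ⊥-elim)
open import Data.Vec.Functional using (tail)
open import Data.List using (List; []; _∷_; _++_; length; map)
open import Data.List.Properties using (length-map)
open import Data.List.Membership.Propositional using () renaming (_∈_ to _∈ₗ_)
open import Data.List.Membership.Propositional.Properties using (∈-++⁺ˡ; ∈-++⁺ʳ; ∈-++⁻)
open import Data.List.Relation.Unary.Any using (here; there)
open import Data.List.Relation.Unary.All as All using (All; []; _∷_)
import Data.List.Relation.Unary.All.Properties as Allₚ
open import Data.List.Relation.Unary.AllPairs using ([]; _∷_)
open import Data.List.Relation.Unary.Unique.Propositional using (Unique)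
import Data.List.Relation.Unary.Unique.Propositional.Properties as Uniqueₚ
open import Data.List.Relation.Binary.Subset.Propositional using () renaming (_⊆_ to _⊆ₗ_)
open import Data.List.Relation.Binary.Disjoint.Propositional using () renaming (Disjoint to Disjointₗ)
open import Function.Base using (_∘_)
open import Function.Bundles using (_⇔_; mk⇔)
open import Function.Definitions using (Injective)
open import Relation.Nullary using (¬_; ¬?; yes; no; does; Dec)
open import Relation.Nullary.Decidable using (dec-true; dec-false; _×-dec_; decidable-stable)
open import Relation.Binary.PropositionalEquality using (_≡_; _≢_; refl; sym; trans; cong; cong₂; subst; subst₂)

private
  variable
    m : ℕ
    a b : Bool

true≢false : a ≡ true → a ≡ false → ⊥
true≢false refl ()

∧-intro : a ≡ true → b ≡ true → a ∧ b ≡ true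
∧-intro refl refl = refl

∧-elimˡ : a ∧ b ≡ true → a ≡ true
∧-elimˡ {true} _ = refl

∧-elimʳ : a ∧ b ≡ true → b ≡ true
∧-elimʳ {true} p = p

∨-introˡ : a ≡ true → a ∨ b ≡ true
∨-introˡ refl = refl

∨-introʳ : ∀ {a b} → b ≡ true → a ∨ b ≡ true
∨-introʳ {a = true} _ = refl
∨-introʳ {a = false} p = p

∨-elim : a ∨ b ≡ true → a ≡ true ⊎ b ≡ true
∨-elim {true} _ = inj₁ refl
∨-elim {false} p = inj₂ p

∨-false : a ≡ false → b ≡ false → a ∨ b ≡ false
∨-false refl refl = refl

∨-false⁻ : a ∨ b ≡ false → a ≡ false × b ≡ false
∨-false⁻ {false} {false} _ = refl , refl

not-true : not a ≡ true → a ≡ false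
not-true {false} _ = refl

not-false : a ≡ false → not a ≡ true
not-false refl = refl

true-or-false : (a : Bool) → a ≡ true ⊎ a ≡ false
true-or-false true = inj₁ refl
true-or-false false = inj₂ refl

∉-single : ∀ {A : Set} {u a : A} → u ≢ a → ¬ u ∈ₗ a ∷ []
∉-single u≢a (here u≡a) = u≢a u≡a

∉-pair : ∀ {A : Set} {u a b : A} → u ≢ a → u ≢ b → ¬ u ∈ₗ a ∷ b ∷ []
∉-pair u≢a _ (here u≡a) = u≢a u≡a
∉-pair _ u≢b (there (here u≡b)) = u≢b u≡b

Disjoint : (Fin m → Bool) → (Fin m → Bool) → Set
Disjoint P Q = ∀ v → P v ≡ true → Q v ≡ true → ⊥

disjoint-false : {P Q : Fin m → Bool} → Disjoint P Q → ∀ {v} → Q v ≡ true → P v ≡ false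
disjoint-false {P = P} P#Q {v} qv with true-or-false (P v)
... | inj₁ pv = ⊥-elim (P#Q v pv qv)
... | inj₂ pv = pv


count-cong : {f g : Fin m → Bool} → (∀ u → f u ≡ g u) → count f ≡ count g
count-cong {zero} e = refl
count-cong {suc m} e rewrite e zero = cong (_ +_) (count-cong (λ i → e (suc i)))

count-empty : count {m} (λ _ → false) ≡ 0
count-empty {zero} = refl
count-empty {suc m} = count-empty {m}

count-mono : {f g : Fin m → Bool} → (∀ u → f u ≡ true → g u ≡ true) → count f ≤ count g
count-mono {zero} _ = z≤n
count-mono {suc m} {f} {g} f⊆g with f zero in fz | g zero in gz
... | true  | true  = s≤s (count-mono (λ u → f⊆g (suc u)))
... | true  | false = ⊥-elim (true≢false (f⊆g zero fz) gz)
... | false | true  = ≤-trans (count-mono (λ u → f⊆g (suc u))) (n≤1+n _)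
... | false | false = count-mono (λ u → f⊆g (suc u))

count-∨ : (f g : Fin m → Bool) → count (λ u → f u ∨ g u) ≤ count f + count g
count-∨ {zero} f g = z≤n
count-∨ {suc m} f g with f zero | g zero
... | true  | true  = s≤s (≤-trans (count-∨ (tail f) (tail g)) (≤-trans (n≤1+n _) (≤-reflexive (sym (+-suc _ _)))))
... | true  | false = s≤s (count-∨ (tail f) (tail g))
... | false | true  = ≤-trans (s≤s (count-∨ (tail f) (tail g))) (≤-reflexive (sym (+-suc _ _)))
... | false | false = count-∨ (tail f) (tail g)

count-nonempty : (f : Fin m → Bool) → 1 ≤ count f → ∃ λ a → f a ≡ true
count-nonempty {suc m} f p with f zero in fz
... | true  = zero , fz
... | false with count-nonempty (λ i → f (suc i)) p
...   | a , fa = suc a , fa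

_without_ : (Fin m → Bool) → Fin m → Fin m → Bool
(f without a) u = f u ∧ not (does (u ≟ a))

without-⊆ : (f : Fin m → Bool) (a : Fin m) {u : Fin m} → (f without a) u ≡ true → f u ≡ true
without-⊆ f a = ∧-elimˡ

without-≢ : (f : Fin m → Bool) (a : Fin m) {u : Fin m} → (f without a) u ≡ true → u ≢ a
without-≢ f a p refl rewrite dec-true (a ≟ a) refl | ∧-zeroʳ (f a) = true≢false p refl

without-keeps : (f : Fin m → Bool) (a : Fin m) {u : Fin m} → f u ≡ true → u ≢ a → (f without a) u ≡ true
without-keeps f a {u} fu u≢a rewrite dec-false (u ≟ a) u≢a | fu = refl

without-removes : (f : Fin m → Bool) (a : Fin m) {u : Fin m} → f u ≡ true → (f without a) u ≡ false → u ≡ a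
without-removes f a {u} fu p with u ≟ a
... | yes u≡a = u≡a
... | no u≢a rewrite fu = ⊥-elim (true≢false refl p)

count-without : (f : Fin m → Bool) (a : Fin m) → f a ≡ true → count f ≡ suc (count (f without a))
count-without f zero fa rewrite fa = cong suc (count-cong (λ i → sym (∧-identityʳ (f (suc i)))))
count-without f (suc a) fa =
  trans (cong₂ _+_ (cong (λ b → if b then 1 else 0) (sym (∧-identityʳ (f zero))))
                   (count-without (tail f) a fa))
        (+-suc _ _)

count-without-≤ : (f : Fin m → Bool) (a : Fin m) → count f ≤ suc (count (f without a))
count-without-≤ f a with f a in fa
... | true  = ≤-reflexive (count-without f a fa)
... | false = ≤-trans (≤-reflexive (count-cong same)) (n≤1+n _)
  where
  same : ∀ u → f u ≡ (f without a) u
  same u with u ≟ a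
  ... | yes refl = trans fa (sym (∧-zeroʳ _))
  ... | no _ = sym (∧-identityʳ (f u))

count-two : (f : Fin m → Bool) → 2 ≤ count f → ∃₂ λ a b → a ≢ b × f a ≡ true × f b ≡ true
count-two f p with count-nonempty f (≤-trans (s≤s z≤n) p)
... | a , fa with count-nonempty (f without a) (≤-pred (≤-trans p (≤-reflexive (count-without f a fa))))
...   | b , fb = a , b , (λ a≡b → without-≢ f a fb (sym a≡b)) , fa , without-⊆ f a fb

count≤length : (f : Fin m → Bool) (l : List (Fin m)) → (∀ u → f u ≡ true → u ∈ₗ l) → count f ≤ length l
count≤length {m} f [] f⊆l = ≤-reflexive (trans (count-cong none) (count-empty {m}))
  where
  none : ∀ u → f u ≡ false
  none u with f u in fu
  ... | true  with () ← f⊆l u fu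
  ... | false = refl
count≤length f (a ∷ l) f⊆l =
  ≤-trans (count-without-≤ f a) (s≤s (count≤length (f without a) l rest))
  where
  rest : ∀ u → (f without a) u ≡ true → u ∈ₗ l
  rest u p with f⊆l u (without-⊆ f a p)
  ... | here u≡a = ⊥-elim (without-≢ f a p u≡a)
  ... | there u∈l = u∈l

module _ {m : ℕ} where
  open import Data.List.Membership.DecPropositional (_≟_ {m}) using (_∈?_)

  ⟦_⟧ : List (Fin m) → Fin m → Bool
  ⟦ l ⟧ u = does (u ∈? l)

  ∉⇒⟦⟧-false : ∀ l {u} → ¬ u ∈ₗ l → ⟦ l ⟧ u ≡ false
  ∉⇒⟦⟧-false l {u} = dec-false (u ∈? l)

  ∈⇒⟦⟧-true : ∀ {l u} → u ∈ₗ l → ⟦ l ⟧ u ≡ true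
  ∈⇒⟦⟧-true {l} {u} = dec-true (u ∈? l)

  ⟦⟧-false⇒∉ : ∀ l {u} → ⟦ l ⟧ u ≡ false → ¬ u ∈ₗ l
  ⟦⟧-false⇒∉ l l∌u u∈l = true≢false (∈⇒⟦⟧-true u∈l) l∌u

  count-⟦⟧ : (l : List (Fin m)) → count ⟦ l ⟧ ≤ length l
  count-⟦⟧ l = count≤length ⟦ l ⟧ l λ u p → ⟦⟧-true⇒∈ p
    where
    ⟦⟧-true⇒∈ : ∀ {u} → ⟦ l ⟧ u ≡ true → u ∈ₗ l
    ⟦⟧-true⇒∈ {u} p with u ∈? l
    ... | yes u∈l = u∈l

-- Counting sets of vertices and (ordered) vertex pairs together, as in the
-- separator of a mixed separation

Mixed : ℕ → Set
Mixed m = Fin m ⊎ (Fin m × Fin m)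

_∈ᵐ_ : Mixed m → (Fin m → Bool) × (Fin m → Fin m → Bool) → Set
inj₁ v ∈ᵐ (f , h) = f v ≡ true
inj₂ (u , v) ∈ᵐ (f , h) = h u v ≡ true

mixedSize : (Fin m → Bool) → (Fin m → Fin m → Bool) → ℕ
mixedSize f h = count f + sumFin (λ u → count (h u))

sumFin-cong : {g g′ : Fin m → ℕ} → (∀ u → g u ≡ g′ u) → sumFin g ≡ sumFin g′
sumFin-cong {zero} e = refl
sumFin-cong {suc m} e = cong₂ _+_ (e zero) (sumFin-cong (λ i → e (suc i)))

sumFin-decrement : (g g′ : Fin m → ℕ) (a : Fin m) → g a ≡ suc (g′ a) →
  (∀ u → u ≢ a → g u ≡ g′ u) → sumFin g ≡ suc (sumFin g′)
sumFin-decrement g g′ zero ga rest rewrite ga =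
  cong (λ s → suc (g′ zero + s)) (sumFin-cong (λ i → rest (suc i) λ ()))
sumFin-decrement g g′ (suc a) ga rest =
  trans (cong₂ _+_ (rest zero λ ())
                   (sumFin-decrement (λ i → g (suc i)) (λ i → g′ (suc i)) a ga
                                     (λ u u≢a → rest (suc u) (λ e → u≢a (suc-injective e)))))
        (+-suc (g′ zero) _)

_withoutPair_ : (Fin m → Fin m → Bool) → Fin m × Fin m → Fin m → Fin m → Bool
(h withoutPair (a , b)) u = if does (u ≟ a) then h u without b else h u

mixedSize-withoutPair : (f : Fin m → Bool) (h : Fin m → Fin m → Bool) (a b : Fin m) → h a b ≡ true →
  mixedSize f h ≡ suc (mixedSize f (h withoutPair (a , b)))
mixedSize-withoutPair f h a b hab =
  trans (cong (count f +_) (sumFin-decrement _ _ a at-a elsewhere)) (+-suc _ _)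
  where
  at-a : count (h a) ≡ suc (count ((h withoutPair (a , b)) a))
  at-a rewrite dec-true (a ≟ a) refl = count-without (h a) b hab
  elsewhere : ∀ u → u ≢ a → count (h u) ≡ count ((h withoutPair (a , b)) u)
  elsewhere u u≢a rewrite dec-false (u ≟ a) u≢a = refl

withoutPair-keeps : (h : Fin m → Fin m → Bool) {a b u v : Fin m} → h u v ≡ true →
  (u , v) ≢ (a , b) → (h withoutPair (a , b)) u v ≡ true
withoutPair-keeps h {a} {b} {u} {v} huv ne with u ≟ a
... | no _ = huv
... | yes refl = without-keeps (h u) b huv (λ v≡b → ne (cong (u ,_) v≡b))

unique-length≤mixedSize : (f : Fin m → Bool) (h : Fin m → Fin m → Bool) (l : List (Mixed m)) →
  Unique l → All (_∈ᵐ (f , h)) l → length l ≤ mixedSize f h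
unique-length≤mixedSize f h [] _ _ = z≤n
unique-length≤mixedSize f h (inj₁ a ∷ l) (a∉l ∷ l!) (fa ∷ l⊆) =
  ≤-trans (s≤s (unique-length≤mixedSize (f without a) h l l! (All.zipWith keep (a∉l , l⊆))))
          (≤-reflexive (sym (cong (_+ _) (count-without f a fa))))
  where
  keep : ∀ {e} → inj₁ a ≢ e × e ∈ᵐ (f , h) → e ∈ᵐ (f without a , h)
  keep {inj₁ v} (ne , fv) = without-keeps f a fv (λ v≡a → ne (cong inj₁ (sym v≡a)))
  keep {inj₂ _} (_ , p) = p
unique-length≤mixedSize f h (inj₂ (a , b) ∷ l) (ab∉l ∷ l!) (hab ∷ l⊆) =
  ≤-trans (s≤s (unique-length≤mixedSize f (h withoutPair (a , b)) l l! (All.zipWith keep (ab∉l , l⊆))))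
          (≤-reflexive (sym (mixedSize-withoutPair f h a b hab)))
  where
  keep : ∀ {e} → inj₂ (a , b) ≢ e × e ∈ᵐ (f , h) → e ∈ᵐ (f , h withoutPair (a , b))
  keep {inj₁ _} (_ , p) = p
  keep {inj₂ (u , v)} (ne , huv) = withoutPair-keeps h huv (λ e → ne (cong inj₂ (sym e)))

unique-length≤count : (f : Fin m → Bool) (l : List (Fin m)) → Unique l → All (λ v → f v ≡ true) l → length l ≤ count f
unique-length≤count f [] _ _ = z≤n
unique-length≤count f (a ∷ l) (a∉l ∷ l!) (fa ∷ l⊆) =
  ≤-trans (s≤s (unique-length≤count (f without a) l l! (All.zipWith keep (a∉l , l⊆))))
          (≤-reflexive (sym (count-without f a fa)))
  where
  keep : ∀ {v} → a ≢ v × f v ≡ true → (f without a) v ≡ true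
  keep (ne , fv) = without-keeps f a fv (λ v≡a → ne (sym v≡a))

distinct-two : (f : Fin m → Bool) (a b : Fin m) → a ≢ b → f a ≡ true → f b ≡ true → 2 ≤ count f
distinct-two f a b a≢b fa fb = unique-length≤count f (a ∷ b ∷ []) ((a≢b ∷ []) ∷ [] ∷ []) (fa ∷ fb ∷ [])

distinct-four : (f : Fin m → Bool) (a b c d : Fin m) →
  a ≢ b → a ≢ c → a ≢ d → b ≢ c → b ≢ d → c ≢ d →
  f a ≡ true → f b ≡ true → f c ≡ true → f d ≡ true → 4 ≤ count f
distinct-four f a b c d ab ac ad bc bd cd fa fb fc fd =
  unique-length≤count f (a ∷ b ∷ c ∷ d ∷ [])
    ((ab ∷ ac ∷ ad ∷ []) ∷ (bc ∷ bd ∷ []) ∷ (cd ∷ []) ∷ [] ∷ []) (fa ∷ fb ∷ fc ∷ fd ∷ [])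

module Walks (G : Graph) where
  open Graph G

  adjˡ : ∀ {u v} → adj u v ≡ true → adj v u ≡ true
  adjˡ {u} {v} e = trans (adj-sym v u) e

  adj⇒≢ : ∀ {u v} → adj u v ≡ true → u ≢ v
  adj⇒≢ {u} e refl = true≢false e (adj-irr u)

  reach-start : ∀ {S u v} → Reach G S u v → S u ≡ true
  reach-start (here su) = su
  reach-start (step su _ _) = su

  reach-end : ∀ {S u v} → Reach G S u v → S v ≡ true
  reach-end (here sv) = sv
  reach-end (step _ _ r) = reach-end r

  reach-mono : ∀ {S T u v} → (∀ z → S z ≡ true → T z ≡ true) → Reach G S u v → Reach G T u v
  reach-mono S⊆T (here su) = here (S⊆T _ su)
  reach-mono S⊆T (step su e r) = step (S⊆T _ su) e (reach-mono S⊆T r)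

  reach-snoc : ∀ {S u v w} → Reach G S u v → adj v w ≡ true → S w ≡ true → Reach G S u w
  reach-snoc (here sv) e sw = step sv e (here sw)
  reach-snoc (step su e r) e′ sw = step su e (reach-snoc r e′ sw)

  reach-trans : ∀ {S u v w} → Reach G S u v → Reach G S v w → Reach G S u w
  reach-trans (here _) r′ = r′
  reach-trans (step su e r) r′ = step su e (reach-trans r r′)

  reach-sym : ∀ {S u v} → Reach G S u v → Reach G S v u
  reach-sym (here su) = here su
  reach-sym (step su e r) = reach-snoc (reach-sym r) (adjˡ e) su

  reach-exit : ∀ {R W : VSet G} {u v} → Reach G R u v → W u ≡ true →
    Reach G (λ z → W z ∧ R z) u v
    ⊎ Σ (Fin n) λ p → Σ (Fin n) λ w →
        Reach G (λ z → W z ∧ R z) u p × adj p w ≡ true × R w ≡ true × W w ≡ false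
  reach-exit (here ru) wu = inj₁ (here (∧-intro wu ru))
  reach-exit {W = W} (step {u} {w} ru e r) wu with W w in ww
  ... | false = inj₂ (u , w , here (∧-intro wu ru) , e , reach-start r , ww)
  ... | true with reach-exit {W = W} r ww
  ...   | inj₁ r′ = inj₁ (step (∧-intro wu ru) e r′)
  ...   | inj₂ (p , w′ , r′ , exit) = inj₂ (p , w′ , step (∧-intro wu ru) e r′ , exit)

  connected-cong : ∀ {S T} → (∀ v → S v ≡ T v) → Connected G S → Connected G T
  connected-cong S≐T ((v , sv) , conn) =
    (v , trans (sym (S≐T v)) sv) ,
    λ u w tu tw → reach-mono (λ z sz → trans (sym (S≐T z)) sz) (conn u w (trans (S≐T u) tu) (trans (S≐T w) tw))

  module Components {X : VSet G} where

    component-avoids : ∀ {Q u} → IsComponent G X Q → Q u ≡ true → X u ≡ false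
    component-avoids (Q⊆∁X , _) qu = not-true (Q⊆∁X _ qu)

    X⇒∉component : ∀ {Q v} → IsComponent G X Q → X v ≡ true → Q v ≡ false
    X⇒∉component {Q} {v} Q-comp xv with Q v in qv
    ... | true = ⊥-elim (true≢false xv (component-avoids Q-comp qv))
    ... | false = refl

    component-connected : ∀ {Q u v} → IsComponent G X Q → Q u ≡ true → Q v ≡ true → Reach G Q u v
    component-connected (_ , (_ , conn) , _) = conn _ _

    component-nonempty : ∀ {Q} → IsComponent G X Q → ∃ λ q → Q q ≡ true
    component-nonempty (_ , (q , _) , _) = q

    component-step : ∀ {Q u w} → IsComponent G X Q → Q u ≡ true → adj u w ≡ true → X w ≡ false → Q w ≡ true
    component-step (_ , _ , closed) = closed _ _

    component-closed : ∀ {Q u v} → IsComponent G X Q → Q u ≡ true → Reach G (∁ G X) u v → Q v ≡ true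
    component-closed cQ qu (here _) = qu
    component-closed cQ qu (step _ e r) = component-closed cQ (component-step cQ qu e (not-true (reach-start r))) r

    component-reach : ∀ {Q u v} → IsComponent G X Q → Q u ≡ true → Q v ≡ true → Reach G (∁ G X) u v
    component-reach cQ@(_ , (_ , conn) , _) qu qv =
      reach-mono (λ z qz → not-false (component-avoids cQ qz)) (conn _ _ qu qv)

    components-equal : ∀ {Q Q′ v} → IsComponent G X Q → IsComponent G X Q′ →
      Q v ≡ true → Q′ v ≡ true → ∀ u → Q u ≡ Q′ u
    components-equal {Q} {Q′} cQ cQ′ qv q′v u with Q u in qu | Q′ u in q′u
    ... | true  | true  = refl
    ... | false | false = refl
    ... | true  | false = ⊥-elim (true≢false (component-closed cQ′ q′v (component-reach cQ qv qu)) q′u)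
    ... | false | true  = ⊥-elim (true≢false (component-closed cQ qv (component-reach cQ′ q′v q′u)) qu)

    distinct-components-disjoint : ∀ {Q Q′} → IsComponent G X Q → IsComponent G X Q′ → ¬ (_≐_ G Q Q′) → Disjoint Q Q′
    distinct-components-disjoint cQ cQ′ Q≠Q′ v qv q′v = Q≠Q′ (components-equal cQ cQ′ qv q′v)

    separated⇒disjoint : ∀ {Q Q′ k} → IsComponent G X Q → IsComponent G X Q′ → Q k ≡ true → Q′ k ≡ false → Disjoint Q Q′
    separated⇒disjoint cQ cQ′ qk q′k v qv q′v = true≢false (trans (components-equal cQ′ cQ q′v qv _) qk) q′k

    shared⇒disjoint : ∀ {K Q Q′ k} → IsComponent G X K → IsComponent G X Q → K k ≡ true → Q k ≡ true →
      Disjoint Q Q′ → Disjoint K Q′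
    shared⇒disjoint cK cQ kk qk Q#Q′ v kv q′v = Q#Q′ v (trans (components-equal cQ cK qk kk v) kv) q′v

    two-other-components : ∀ {K} → IsComponent G X K → AtLeastThreeComponents G X →
      ∃₂ λ L M → IsComponent G X L × IsComponent G X M × Disjoint K L × Disjoint K M × Disjoint L M
    two-other-components {K} cK (K₁ , K₂ , K₃ , c₁ , c₂ , c₃ , K₁≠K₂ , K₁≠K₃ , K₂≠K₃) = choose (component-nonempty cK)
      where
      d₁₂ : Disjoint K₁ K₂
      d₁₂ = distinct-components-disjoint c₁ c₂ K₁≠K₂
      d₁₃ : Disjoint K₁ K₃
      d₁₃ = distinct-components-disjoint c₁ c₃ K₁≠K₃
      d₂₃ : Disjoint K₂ K₃
      d₂₃ = distinct-components-disjoint c₂ c₃ K₂≠K₃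
      choose : (∃ λ k → K k ≡ true) →
        ∃₂ λ L M → IsComponent G X L × IsComponent G X M × Disjoint K L × Disjoint K M × Disjoint L M
      choose (k , kk) with true-or-false (K₁ k) | true-or-false (K₂ k)
      ... | inj₁ k₁ | _       = K₂ , K₃ , c₂ , c₃ , shared⇒disjoint cK c₁ kk k₁ d₁₂ , shared⇒disjoint cK c₁ kk k₁ d₁₃ , d₂₃
      ... | inj₂ k₁ | inj₁ k₂ = K₁ , K₃ , c₁ , c₃ , separated⇒disjoint cK c₁ kk k₁ , shared⇒disjoint cK c₂ kk k₂ d₂₃ , d₁₃
      ... | inj₂ k₁ | inj₂ k₂ = K₁ , K₂ , c₁ , c₂ , separated⇒disjoint cK c₁ kk k₁ , separated⇒disjoint cK c₂ kk k₂ , d₁₂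

module Paths (G : Graph) where
  open Graph G
  open Walks G using (adjˡ)
  open import Data.List.Membership.DecPropositional (_≟_ {n}) using (_∈?_)

  data Path (S : VSet G) : Fin n → Fin n → List (Fin n) → Set where
    single : ∀ {u} → S u ≡ true → Path S u u (u ∷ [])
    cons   : ∀ {u w v vs} → S u ≡ true → adj u w ≡ true → ¬ u ∈ₗ vs → Path S w v vs → Path S u v (u ∷ vs)

  private
    variable
      S T : VSet G
      u v w : Fin n
      vs : List (Fin n)

  path-inside : Path S u v vs → All (λ z → S z ≡ true) vs
  path-inside (single su) = su ∷ []
  path-inside (cons su _ _ p) = su ∷ path-inside p

  path-avoids : ∀ {z} → Path S u v vs → S z ≡ false → ¬ z ∈ₗ vs
  path-avoids p sz z∈vs = true≢false (All.lookup (path-inside p) z∈vs) sz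

  path-unique : Path S u v vs → Unique vs
  path-unique (single _) = [] ∷ []
  path-unique (cons _ _ u∉vs p) = Allₚ.¬Any⇒All¬ _ u∉vs ∷ path-unique p

  path-length≤count : Path S u v vs → length vs ≤ count S
  path-length≤count p = unique-length≤count _ _ (path-unique p) (path-inside p)

  path-first : Path S u v vs → u ∈ₗ vs
  path-first (single _) = here refl
  path-first (cons _ _ _ _) = here refl

  path-last : Path S u v vs → v ∈ₗ vs
  path-last (single _) = here refl
  path-last (cons _ _ _ p) = there (path-last p)

  path-restrict : Path S u v vs → All (λ z → T z ≡ true) vs → Path T u v vs
  path-restrict (single _) (tu ∷ []) = single tu
  path-restrict (cons _ e u∉vs p) (tu ∷ ts) = cons tu e u∉vs (path-restrict p ts)

  path-mono : (∀ z → S z ≡ true → T z ≡ true) → Path S u v vs → Path T u v vs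
  path-mono S⊆T p = path-restrict p (All.map (S⊆T _) (path-inside p))

  suffix : Path S u v vs → w ∈ₗ vs → ∃ λ ws → Path S w v ws × ws ⊆ₗ vs
  suffix p@(single _) (here refl) = _ , p , λ z∈ → z∈
  suffix p@(cons _ _ _ _) (here refl) = _ , p , λ z∈ → z∈
  suffix (cons _ _ _ p) (there w∈vs) with suffix p w∈vs
  ... | ws , q , ws⊆vs = ws , q , λ z∈ → there (ws⊆vs z∈)

  prefix : Path S u v vs → w ∈ₗ vs → ∃ λ ws → Path S u w ws × ws ⊆ₗ vs
  prefix (single su) (here refl) = _ , single su , λ z∈ → z∈
  prefix (cons su _ _ _) (here refl) = _ , single su , λ { (here refl) → here refl }
  prefix (cons su e u∉vs p) (there w∈vs) with prefix p w∈vs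
  ... | ws , q , ws⊆vs = _ , cons su e (λ u∈ws → u∉vs (ws⊆vs u∈ws)) q ,
                         λ { (here refl) → here refl ; (there z∈) → there (ws⊆vs z∈) }

  walk⇒path : Reach G S u v → ∃ λ vs → Path S u v vs
  walk⇒path (here su) = _ , single su
  walk⇒path {u = u} (step su e r) with walk⇒path r
  ... | vs , p with u ∈? vs
  ...   | yes u∈vs = proj₁ (suffix p u∈vs) , proj₁ (proj₂ (suffix p u∈vs))
  ...   | no u∉vs = _ , cons su e u∉vs p

  append : ∀ {a b c d as cs} → Path S a b as → adj b c ≡ true → Path S c d cs → Disjointₗ as cs →
    Path S a d (as ++ cs)
  append (single sa) e q disj = cons sa e (λ a∈cs → disj (here refl , a∈cs)) q
  append {as = a ∷ as} {cs} (cons sa e a∉as p) e′ q disj =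
    cons sa e a∉ (append p e′ q (λ (z∈as , z∈cs) → disj (there z∈as , z∈cs)))
    where
    a∉ : ¬ a ∈ₗ as ++ cs
    a∉ a∈ with ∈-++⁻ as a∈
    ... | inj₁ a∈as = a∉as a∈as
    ... | inj₂ a∈cs = disj (here refl , a∈cs)

  reverse : Path S u v vs → ∃ λ rs → Path S v u rs × rs ⊆ₗ vs × vs ⊆ₗ rs
  reverse (single su) = _ , single su , (λ z∈ → z∈) , (λ z∈ → z∈)
  reverse {u = u} (cons su e u∉vs p) with reverse p
  ... | rs , q , rs⊆vs , vs⊆rs =
    rs ++ u ∷ [] ,
    append q (adjˡ e) (single su) (λ { (u∈rs , here refl) → u∉vs (rs⊆vs u∈rs) }) ,
    (λ z∈ → back (∈-++⁻ rs z∈)) ,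
    λ { (here refl) → ∈-++⁺ʳ rs (here refl) ; (there z∈) → ∈-++⁺ˡ (vs⊆rs z∈) }
    where
    back : ∀ {z} → z ∈ₗ rs ⊎ z ∈ₗ u ∷ [] → z ∈ₗ u ∷ _
    back (inj₁ z∈rs) = there (rs⊆vs z∈rs)
    back (inj₂ (here refl)) = here refl

  -- A path in the form HasCycle asks for: an injective sequence of vertices.
  record Trail (S : VSet G) (u v : Fin n) (vs : List (Fin n)) : Set where
    field
      len         : ℕ
      vertex      : Fin (suc len) → Fin n
      injective   : Injective _≡_ _≡_ vertex
      inside      : ∀ i → S (vertex i) ≡ true
      consecutive : ∀ (i : Fin len) → adj (vertex (inject₁ i)) (vertex (suc i)) ≡ true
      first       : vertex zero ≡ u
      last        : vertex (fromℕ len) ≡ v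
      listed      : ∀ i → vertex i ∈ₗ vs

  trail : Path S u v vs → Trail S u v vs
  trail {u = u} (single su) = record
    { len = 0 ; vertex = λ _ → u ; injective = λ { {zero} {zero} _ → refl } ; inside = λ _ → su
    ; consecutive = λ () ; first = refl ; last = refl ; listed = λ _ → here refl }
  trail {S = S} {u = u} {v = v} {vs = u ∷ vs} (cons {w = w} su e u∉vs p) = record
    { len = suc (Trail.len t) ; vertex = vertex ; injective = injective ; inside = inside
    ; consecutive = consecutive ; first = refl ; last = Trail.last t ; listed = listed }
    where
    t : Trail S w v vs
    t = trail p
    vertex : Fin (suc (suc (Trail.len t))) → Fin n
    vertex zero = u
    vertex (suc i) = Trail.vertex t i
    injective : Injective _≡_ _≡_ vertex
    injective {zero} {zero} _ = refl
    injective {zero} {suc j} u≡ = ⊥-elim (u∉vs (subst (_∈ₗ vs) (sym u≡) (Trail.listed t j)))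
    injective {suc i} {zero} ≡u = ⊥-elim (u∉vs (subst (_∈ₗ vs) ≡u (Trail.listed t i)))
    injective {suc i} {suc j} eq = cong suc (Trail.injective t eq)
    inside : ∀ i → S (vertex i) ≡ true
    inside zero = su
    inside (suc i) = Trail.inside t i
    consecutive : ∀ (i : Fin (suc (Trail.len t))) → adj (vertex (inject₁ i)) (vertex (suc i)) ≡ true
    consecutive zero rewrite Trail.first t = e
    consecutive (suc i) = Trail.consecutive t i
    listed : ∀ i → vertex i ∈ₗ u ∷ vs
    listed zero = here refl
    listed (suc i) = there (Trail.listed t i)

  -- The third vertex w guarantees that the closed path has length at least three.
  path-cycle : Path S u v vs → adj v u ≡ true → w ∈ₗ vs → w ≢ u → w ≢ v → HasCycle G S
  path-cycle (single _) _ (here refl) w≢u _ = ⊥-elim (w≢u refl)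
  path-cycle (cons _ _ _ (single _)) _ (here refl) w≢u _ = ⊥-elim (w≢u refl)
  path-cycle (cons _ _ _ (single _)) _ (there (here refl)) _ w≢v = ⊥-elim (w≢v refl)
  path-cycle {S = S} {u = u} {v = v} {vs = vs} p@(cons _ _ _ (cons _ _ _ q)) vu _ _ _ =
    Trail.len (trail q) , Trail.vertex t , Trail.injective t , Trail.inside t , Trail.consecutive t ,
    subst₂ (λ a b → adj a b ≡ true) (sym (Trail.last t)) (sym (Trail.first t)) vu
    where
    t : Trail S u v vs
    t = trail p

  hasCycle-mono : (∀ z → S z ≡ true → T z ≡ true) → HasCycle G S → HasCycle G T
  hasCycle-mono S⊆T (m , c , inj , inside , steps , closing) = m , c , inj , (λ i → S⊆T _ (inside i)) , steps , closing

AtMostThree : ∀ {A : Set} → (A → Set) → Set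
AtMostThree {A} P = ∀ (l : List A) → Unique l → All P l → length l ≤ 3

module Separators (G : Graph) where
  open Graph G
  open Walks G using (adjˡ)

  crossEdge : VSet G → VSet G → Fin n → Fin n → Bool
  crossEdge C D a b = (_∖_ G C D) a ∧ (adj a b ∧ (_∖_ G D C) b)

  InSeparator : VSet G → VSet G → Mixed n → Set
  InSeparator C D e = e ∈ᵐ (_∩_ G C D , crossEdge C D)

  separatorSize≡mixedSize : ∀ C D → separatorSize G C D ≡ mixedSize (_∩_ G C D) (crossEdge C D)
  separatorSize≡mixedSize C D = cong (count (_∩_ G C D) +_) (sumFin-cong same)
    where
    same : ∀ u → (if (_∖_ G C D) u then count (λ v → adj u v ∧ (_∖_ G D C) v) else 0) ≡ count (crossEdge C D u)
    same u with (_∖_ G C D) u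
    ... | true = refl
    ... | false = sym (count-empty {m = n})

  separator-at-most-three : ∀ C D → separatorSize G C D ≡ 3 → AtMostThree (InSeparator C D)
  separator-at-most-three C D |sep|≡3 l l! l⊆ =
    ≤-trans (unique-length≤mixedSize _ _ l l! l⊆) (≤-reflexive (trans (sym (separatorSize≡mixedSize C D)) |sep|≡3))

  -- The end of a separator element on the side C of (C , D).
  base : Mixed n → Fin n
  base (inj₁ v) = v
  base (inj₂ (a , _)) = a

  AttachedAt : Fin n → Mixed n → Set
  AttachedAt p (inj₁ v) = adj p v ≡ true
  AttachedAt p (inj₂ (_ , b)) = b ≡ p

  InRegion : VSet G → Mixed n → Set
  InRegion Q (inj₁ v) = Q v ≡ true
  InRegion Q (inj₂ (a , b)) = Q a ≡ true ⊎ Q b ≡ true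

  base-in-region : ∀ {Q} e → Q (base e) ≡ true → InRegion Q e
  base-in-region (inj₁ _) q = q
  base-in-region (inj₂ _) q = inj₁ q

  flip : Mixed n → Mixed n
  flip (inj₁ v) = inj₁ v
  flip (inj₂ (a , b)) = inj₂ (b , a)

  flip-injective : ∀ {e e′} → flip e ≡ flip e′ → e ≡ e′
  flip-injective {inj₁ _} {inj₁ _} refl = refl
  flip-injective {inj₂ _} {inj₂ _} refl = refl

  flip-separator : ∀ C D e → InSeparator D C e → InSeparator C D (flip e)
  flip-separator C D (inj₁ v) e∈ = trans (∧-comm (C v) (D v)) e∈
  flip-separator C D (inj₂ (a , b)) e∈ = ∧-intro (∧-elimʳ {adj a b} a~b∈) (∧-intro (adjˡ (∧-elimˡ a~b∈)) a∈)
    where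
    a∈ : (_∖_ G D C) a ≡ true
    a∈ = ∧-elimˡ e∈
    a~b∈ : adj a b ∧ (_∖_ G C D) b ≡ true
    a~b∈ = ∧-elimʳ {(_∖_ G D C) a} e∈

  at-most-three-flip : ∀ C D → AtMostThree (InSeparator C D) → AtMostThree (InSeparator D C)
  at-most-three-flip C D ≤3 l l! l⊆ =
    ≤-trans (≤-reflexive (sym (length-map flip l)))
      (≤3 (map flip l) (Uniqueₚ.map⁺ flip-injective l!) (Allₚ.map⁺ (All.map (flip-separator C D _) l⊆)))

_≟ᵐ_ : ∀ {m} (e e′ : Mixed m) → Dec (e ≡ e′)
_≟ᵐ_ = Sum.≡-dec _≟_ (Product.≡-dec _≟_ _≟_)

three-exhaust : ∀ {m} {P : Mixed m → Set} → AtMostThree P → ∀ e₁ e₂ e₃ → Unique (e₁ ∷ e₂ ∷ e₃ ∷ []) →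
  All P (e₁ ∷ e₂ ∷ e₃ ∷ []) → ∀ e → P e → e ∈ₗ e₁ ∷ e₂ ∷ e₃ ∷ []
three-exhaust {m} ≤3 e₁ e₂ e₃ l! l⊆ e pe with e ∈? (e₁ ∷ e₂ ∷ e₃ ∷ [])
  where open import Data.List.Membership.DecPropositional (_≟ᵐ_ {m}) using (_∈?_)
... | yes e∈ = e∈
... | no e∉ with ≤3 (e ∷ e₁ ∷ e₂ ∷ e₃ ∷ []) (Allₚ.¬Any⇒All¬ _ e∉ ∷ l!) (pe ∷ l⊆)
...   | s≤s (s≤s (s≤s ()))

<ᵇ2-false⇒2≤ : ∀ k → (k <ᵇ 2) ≡ false → 2 ≤ k
<ᵇ2-false⇒2≤ (suc (suc k)) _ = s≤s (s≤s z≤n)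

2≤⇒<ᵇ2-false : ∀ {k} → 2 ≤ k → (k <ᵇ 2) ≡ false
2≤⇒<ᵇ2-false (s≤s (s≤s z≤n)) = refl

module Configuration
  (G : Graph) (three-connected : ThreeConnected G)
  (X : VSet G) (|X|≡3 : count X ≡ 3)
  (K L M : VSet G) (K-comp : IsComponent G X K) (L-comp : IsComponent G X L) (M-comp : IsComponent G X M)
  (K#L : Disjoint K L) (K#M : Disjoint K M) (L#M : Disjoint L M)
  where

  open Graph G
  open Walks G
  open Components {X}
  open Paths G
  open Separators G
  open import Data.List.Membership.DecPropositional (_≟_ {n}) using (_∈?_)

  A B A′ B′ : VSet G
  A v = K v ∨ X v
  B v = not (K v)
  A′ = proj₁ (reduction G A B)
  B′ = proj₂ (reduction G A B)

  nbrs : Fin n → VSet G → VSet G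
  nbrs v S u = adj v u ∧ S u

  nbrs-false : ∀ {u w S} → adj u w ≡ true → nbrs u S w ≡ false → S w ≡ false
  nbrs-false u~w n rewrite u~w = n

  ¬4≤|X| : ¬ 4 ≤ count X
  ¬4≤|X| 4≤ with subst (4 ≤_) |X|≡3 4≤
  ... | s≤s (s≤s (s≤s ()))

  connected-after-deleting-two : (Y : VSet G) → count Y ≤ 2 → ∀ {u v} → Y u ≡ false → Y v ≡ false →
    Reach G (∁ G Y) u v
  connected-after-deleting-two Y |Y|≤2 yu yv =
    proj₂ (proj₂ three-connected Y |Y|≤2) _ _ (not-false yu) (not-false yv)

  K-avoids : ∀ {v} → K v ≡ true → X v ≡ false
  K-avoids = component-avoids K-comp

  L-avoids : ∀ {v} → L v ≡ true → X v ≡ false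
  L-avoids = component-avoids L-comp

  M-avoids : ∀ {v} → M v ≡ true → X v ≡ false
  M-avoids = component-avoids M-comp

  X⇒¬K : ∀ {v} → X v ≡ true → K v ≡ false
  X⇒¬K = X⇒∉component K-comp

  X≢ : ∀ {u v} → X u ≡ true → X v ≡ false → u ≢ v
  X≢ xu xv refl = true≢false xu xv

  -- In G − (X − x) a path from Q to Q′ has to leave Q, and it can only do so through x.
  attaches : ∀ {x Q Q′} → X x ≡ true → IsComponent G X Q → IsComponent G X Q′ → Disjoint Q Q′ →
    ∃ λ q → Q q ≡ true × adj x q ≡ true
  attaches {x} {Q} {Q′} xx Q-comp Q′-comp Q#Q′
    with component-nonempty Q-comp | component-nonempty Q′-comp
  ... | q , qq | q′ , q′q′
    with reach-exit {W = Q}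
           (connected-after-deleting-two (X without x) |X-x|≤2
              (off (component-avoids Q-comp qq)) (off (component-avoids Q′-comp q′q′))) qq
    where
    |X-x|≤2 : count (X without x) ≤ 2
    |X-x|≤2 = ≤-pred (≤-trans (≤-reflexive (sym (count-without X x xx))) (≤-reflexive |X|≡3))
    off : ∀ {z} → X z ≡ false → (X without x) z ≡ false
    off xz rewrite xz = refl
  ... | inj₁ r = ⊥-elim (Q#Q′ q′ (∧-elimˡ (reach-end r)) q′q′)
  ... | inj₂ (p , w , r , e , ¬Yw , Qw) with true-or-false (X w)
  ...   | inj₂ xw = ⊥-elim (true≢false (component-step Q-comp (∧-elimˡ (reach-end r)) e xw) Qw)
  ...   | inj₁ xw = p , ∧-elimˡ (reach-end r) ,
                 subst (λ z → adj z p ≡ true) (without-removes X x xw (not-true ¬Yw)) (adjˡ e)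

  nbr-in-K : ∀ {x} → X x ≡ true → ∃ λ q → K q ≡ true × adj x q ≡ true
  nbr-in-K xx = attaches xx K-comp L-comp K#L

  nbr-in-L : ∀ {x} → X x ≡ true → ∃ λ q → L q ≡ true × adj x q ≡ true
  nbr-in-L xx = attaches xx L-comp M-comp L#M

  nbr-in-M : ∀ {x} → X x ≡ true → ∃ λ q → M q ≡ true × adj x q ≡ true
  nbr-in-M xx = attaches xx M-comp L-comp (λ v mv lv → L#M v lv mv)

  component : Fin 3 → VSet G
  component zero = K
  component (suc zero) = L
  component (suc (suc zero)) = M

  component-is : ∀ i → IsComponent G X (component i)
  component-is zero = K-comp
  component-is (suc zero) = L-comp
  component-is (suc (suc zero)) = M-comp

  components-disjoint : ∀ {i j} → i ≢ j → Disjoint (component i) (component j)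
  components-disjoint {zero} {zero} i≢j = ⊥-elim (i≢j refl)
  components-disjoint {zero} {suc zero} _ = K#L
  components-disjoint {zero} {suc (suc zero)} _ = K#M
  components-disjoint {suc zero} {zero} _ v lv kv = K#L v kv lv
  components-disjoint {suc zero} {suc zero} i≢j = ⊥-elim (i≢j refl)
  components-disjoint {suc zero} {suc (suc zero)} _ = L#M
  components-disjoint {suc (suc zero)} {zero} _ v mv kv = K#M v kv mv
  components-disjoint {suc (suc zero)} {suc zero} _ v mv lv = L#M v lv mv
  components-disjoint {suc (suc zero)} {suc (suc zero)} i≢j = ⊥-elim (i≢j refl)

  another : (i : Fin 3) → ∃ λ j → i ≢ j
  another zero = suc zero , λ ()
  another (suc zero) = zero , λ ()
  another (suc (suc zero)) = zero , λ ()

  L⇒¬K : ∀ {v} → L v ≡ true → K v ≡ false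
  L⇒¬K = disjoint-false K#L

  M⇒¬K : ∀ {v} → M v ≡ true → K v ≡ false
  M⇒¬K = disjoint-false K#M

  L≢M : ∀ {a b} → L a ≡ true → M b ≡ true → a ≢ b
  L≢M la mb refl = L#M _ la mb

  2≤nbrs-in-B : ∀ {x} → X x ≡ true → 2 ≤ nbrsIn G x B
  2≤nbrs-in-B xx with nbr-in-L xx | nbr-in-M xx
  ... | l , ll , xl | m , mm , xm =
    distinct-two (nbrs _ B) l m (L≢M ll mm) (∧-intro xl (not-false (L⇒¬K ll))) (∧-intro xm (not-false (M⇒¬K mm)))

  B′≐B : ∀ v → B′ v ≡ B v
  B′≐B v with K v in kv | X v in xv
  ... | true  | _     = refl
  ... | false | false = refl
  ... | false | true rewrite 2≤⇒<ᵇ2-false (2≤nbrs-in-B xv) = refl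

  ¬K⇒B′ : ∀ {v} → K v ≡ false → B′ v ≡ true
  ¬K⇒B′ {v} kv = trans (B′≐B v) (not-false kv)

  B′⇒¬K : ∀ {v} → B′ v ≡ true → K v ≡ false
  B′⇒¬K {v} b′v = not-true (trans (sym (B′≐B v)) b′v)

  A′⇒A : ∀ {v} → A′ v ≡ true → A v ≡ true
  A′⇒A = ∧-elimˡ

  K⇒A′ : ∀ {v} → K v ≡ true → A′ v ≡ true
  K⇒A′ kv rewrite kv = refl

  X⇒A′ : ∀ {v} → X v ≡ true → 2 ≤ nbrsIn G v A → A′ v ≡ true
  X⇒A′ {v} xv 2≤ with K v
  ... | true = refl
  ... | false rewrite xv | 2≤⇒<ᵇ2-false 2≤ = refl

  A′-cases : ∀ {v} → A′ v ≡ true → K v ≡ true ⊎ (X v ≡ true × 2 ≤ nbrsIn G v A)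
  A′-cases {v} a′v with K v in kv | X v in xv
  ... | true  | _    = inj₁ refl
  ... | false | true = inj₂ (refl , <ᵇ2-false⇒2≤ _ (not-true (∧-elimʳ a′v)))

  reduction-≼ : _≐_ G B′ B × _≼_ G (A′ , B′) (A , B)
  reduction-≼ = B′≐B , (λ _ → A′⇒A) , (λ v bv → trans (B′≐B v) bv)

  A′∖B′≐K : ∀ v → (_∖_ G A′ B′) v ≡ K v
  A′∖B′≐K v rewrite B′≐B v with K v
  ... | true  = refl
  ... | false = ∧-zeroʳ _

  reduction-half-connected : HalfConnected G A′ B′
  reduction-half-connected = inj₁ (connected-cong (λ v → sym (A′∖B′≐K v)) (proj₁ (proj₂ K-comp)))

  -- A vertex of A′ ∩ B′ lies in X: it has two neighbours in A and one in each of L and M.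
  reduction-strong : Strong G A′ B′
  reduction-strong v v∈A′∩B′ with A′-cases (∧-elimˡ {A′ v} v∈A′∩B′)
  ... | inj₁ kv = ⊥-elim (true≢false kv (B′⇒¬K (∧-elimʳ {A′ v} v∈A′∩B′)))
  ... | inj₂ (xv , 2≤) with count-two (nbrs v A) 2≤ | nbr-in-L xv | nbr-in-M xv
  ...   | a , b , a≢b , va , vb | l , ll , vl | m , mm , vm =
    distinct-four (adj v) a b l m a≢b (A≢ va (A-L ll)) (A≢ va (A-M mm)) (A≢ vb (A-L ll)) (A≢ vb (A-M mm))
      (L≢M ll mm) (∧-elimˡ va) (∧-elimˡ vb) vl vm
    where
    A≢ : ∀ {p q} → nbrs v A p ≡ true → A q ≡ false → p ≢ q
    A≢ vp aq refl = true≢false (∧-elimʳ vp) aq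
    A-L : ∀ {q} → L q ≡ true → A q ≡ false
    A-L lq rewrite L⇒¬K lq | L-avoids lq = refl
    A-M : ∀ {q} → M q ≡ true → A q ≡ false
    A-M mq rewrite M⇒¬K mq | M-avoids mq = refl


  EdgeInX : Set
  EdgeInX = ∃₂ λ x y → X x ≡ true × X y ≡ true × adj x y ≡ true

  A′∖K⇒edge-in-X : ∀ {v} → A′ v ≡ true → K v ≡ false → ¬ 2 ≤ count K → EdgeInX
  A′∖K⇒edge-in-X {v} a′v kv |K|<2 with A′-cases a′v
  ... | inj₁ kv′ = ⊥-elim (true≢false kv′ kv)
  ... | inj₂ (xv , 2≤) with count-two (nbrs v A) 2≤
  ...   | a , b , a≢b , va , vb with ∨-elim {K a} (∧-elimʳ va) | ∨-elim {K b} (∧-elimʳ vb)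
  ...     | inj₂ xa | _       = v , a , xv , xa , ∧-elimˡ va
  ...     | inj₁ _  | inj₂ xb = v , b , xv , xb , ∧-elimˡ vb
  ...     | inj₁ ka | inj₁ kb = ⊥-elim (|K|<2 (distinct-two K a b a≢b ka kb))

  -- Of two distinct vertices of a cycle in A′, at most one lies in K unless |K| ≥ 2.
  A′-cycle⇒edge-or-|K|≥2 : HasCycle G A′ → EdgeInX ⊎ 2 ≤ count K
  A′-cycle⇒edge-or-|K|≥2 (_ , c , injective , inside , _) with 2 ≤? count K
  ... | yes 2≤ = inj₂ 2≤
  ... | no |K|<2 with true-or-false (K (c zero)) | true-or-false (K (c (suc zero)))
  ...   | inj₂ k₀ | _       = inj₁ (A′∖K⇒edge-in-X (inside _) k₀ |K|<2)
  ...   | inj₁ _  | inj₂ k₁ = inj₁ (A′∖K⇒edge-in-X (inside _) k₁ |K|<2)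
  ...   | inj₁ k₀ | inj₁ k₁ = ⊥-elim (|K|<2 (distinct-two K (c zero) (c (suc zero)) (λ c₀≡c₁ → 0≢1 (injective c₀≡c₁)) k₀ k₁))
    where
    0≢1 : ∀ {m} → Fin.zero {suc m} ≢ suc zero
    0≢1 ()

  -- The cycle runs from x through L to y and back through M.
  B-cycle : HasCycle G B
  B-cycle with count-two X (≤-trans (s≤s (s≤s z≤n)) (≤-reflexive (sym |X|≡3)))
  ... | x , y , x≢y , xx , xy with nbr-in-L xx | nbr-in-L xy | nbr-in-M xy | nbr-in-M xx
  ...   | a , la , xa | b , lb , yb | c , mc , yc | d , md , xd
    with walk⇒path (component-connected L-comp la lb) | walk⇒path (component-connected M-comp mc md)
  ...     | vs , p | ws , q =
    path-cycle path (adjˡ xd) (there (∈-++⁺ʳ vs (here refl))) (λ y≡x → x≢y (sym y≡x)) (X≢ xy (M-avoids md))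
    where
    L⇒B : ∀ z → L z ≡ true → B z ≡ true
    L⇒B _ lz = not-false (L⇒¬K lz)
    M⇒B : ∀ z → M z ≡ true → B z ≡ true
    M⇒B _ mz = not-false (M⇒¬K mz)
    y∉ws : ¬ y ∈ₗ ws
    y∉ws = path-avoids q (X⇒∉component M-comp xy)
    x∉ : ¬ x ∈ₗ vs ++ y ∷ ws
    x∉ x∈ with ∈-++⁻ vs x∈
    ... | inj₁ x∈vs = path-avoids p (X⇒∉component L-comp xx) x∈vs
    ... | inj₂ (here x≡y) = x≢y x≡y
    ... | inj₂ (there x∈ws) = path-avoids q (X⇒∉component M-comp xx) x∈ws
    disjoint : ∀ {z} → ¬ (z ∈ₗ vs × z ∈ₗ y ∷ ws)
    disjoint (z∈vs , here refl) = path-avoids p (X⇒∉component L-comp xy) z∈vs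
    disjoint (z∈vs , there z∈ws) = L#M _ (All.lookup (path-inside p) z∈vs) (All.lookup (path-inside q) z∈ws)
    path : Path B x d (x ∷ vs ++ y ∷ ws)
    path = cons (not-false (X⇒¬K xx)) xa x∉
             (append (path-mono L⇒B p) (adjˡ yb) (cons (not-false (X⇒¬K xy)) yc y∉ws (path-mono M⇒B q)) disjoint)

  edge-in-X⇒A′-cycle : EdgeInX → HasCycle G A′
  edge-in-X⇒A′-cycle (x , y , xx , xy , x~y) with nbr-in-K xx | nbr-in-K xy
  ... | a , ka , x~a | b , kb , y~b with walk⇒path (component-connected K-comp kb ka)
  ...   | vs , p = path-cycle path (adjˡ x~a) (there (here refl)) (λ y≡x → adj⇒≢ x~y (sym y≡x)) (X≢ xy (K-avoids ka))
    where
    X⇒¬vs : ∀ {z} → X z ≡ true → ¬ z ∈ₗ vs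
    X⇒¬vs xz = path-avoids p (X⇒¬K xz)
    x∉ : ¬ x ∈ₗ y ∷ vs
    x∉ (here x≡y) = adj⇒≢ x~y x≡y
    x∉ (there x∈vs) = X⇒¬vs xx x∈vs
    A′x : A′ x ≡ true
    A′x = X⇒A′ xx (distinct-two (nbrs x A) y a (X≢ xy (K-avoids ka)) (∧-intro x~y (∨-introʳ {K y} xy)) (∧-intro x~a (∨-introˡ ka)))
    A′y : A′ y ≡ true
    A′y = X⇒A′ xy (distinct-two (nbrs y A) x b (X≢ xx (K-avoids kb)) (∧-intro (adjˡ x~y) (∨-introʳ {K x} xx)) (∧-intro y~b (∨-introˡ kb)))
    path : Path A′ x a (x ∷ y ∷ vs)
    path = cons A′x x~y x∉ (cons A′y y~b (X⇒¬vs xy) (path-mono (λ z → K⇒A′ {z}) p))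

  Saturated : Fin n → List (Fin n) → Set
  Saturated u vs = ∀ w → K w ≡ true → adj u w ≡ true → w ∈ₗ vs

  -- Prepend new K-neighbours of the front while there are any; a path in K has at most
  -- |K| vertices, which bounds the fuel needed.
  extend : ∀ fuel {u v vs} → Path K u v vs → u ≢ v → count K < length vs + fuel →
    ∃₂ λ u′ vs′ → Path K u′ v vs′ × u′ ≢ v × vs ⊆ₗ vs′ × Saturated u′ vs′
  extend zero p _ |K|< = ⊥-elim (<⇒≱ (subst (count K <_) (+-identityʳ _) |K|<) (path-length≤count p))
  extend (suc fuel) {u} {v} {vs} p u≢v |K|<
    with any? (λ w → (K w Bool.≟ true) ×-dec (adj u w Bool.≟ true) ×-dec ¬? (w ∈? vs))
  ... | yes (w , kw , u~w , w∉vs)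
    with extend fuel (cons kw (adjˡ u~w) w∉vs p) (λ { refl → w∉vs (path-last p) })
                (subst (count K <_) (+-suc (length vs) fuel) |K|<)
  ...   | u′ , vs′ , p′ , u′≢v , w∷vs⊆vs′ , saturated = u′ , vs′ , p′ , u′≢v , (λ z∈ → w∷vs⊆vs′ (there z∈)) , saturated
  extend (suc fuel) {u} {v} {vs} p u≢v |K|< | no none = u , vs , p , u≢v , (λ z∈ → z∈) , saturated
    where
    saturated : Saturated u vs
    saturated w kw u~w with w ∈? vs
    ... | yes w∈vs = w∈vs
    ... | no w∉vs = ⊥-elim (none (w , kw , u~w , w∉vs))

  extend-fully : ∀ {u v vs} → Path K u v vs → u ≢ v →
    ∃₂ λ u′ vs′ → Path K u′ v vs′ × u′ ≢ v × vs ⊆ₗ vs′ × Saturated u′ vs′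
  extend-fully {vs = vs} p u≢v = extend (suc (count K)) p u≢v (m≤n+m (suc (count K)) (length vs))

  -- Deleting s and a lone neighbour in X would separate u from L.
  two-nbrs-in-X : ∀ {u s} → K u ≡ true → K s ≡ true → adj u s ≡ true →
    (∀ w → K w ≡ true → adj u w ≡ true → w ≡ s) → 2 ≤ count (nbrs u X)
  two-nbrs-in-X {u} {s} ku ks u~s only-s = decidable-stable (2 ≤? count (nbrs u X)) λ |N∩X|<2 →
    trapped lt (connected-after-deleting-two Y (|Y|≤2 |N∩X|<2) (Y-false (adj⇒≢ u~s) nbrs-irrefl) (Y-false t≢s t∉N))
    where
    t : Fin n
    t = proj₁ (component-nonempty L-comp)
    lt : L t ≡ true
    lt = proj₂ (component-nonempty L-comp)
    Y : VSet G
    Y z = ⟦ s ∷ [] ⟧ z ∨ nbrs u X z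
    |Y|≤2 : ¬ 2 ≤ count (nbrs u X) → count Y ≤ 2
    |Y|≤2 |N∩X|<2 = ≤-trans (count-∨ ⟦ s ∷ [] ⟧ (nbrs u X)) (+-mono-≤ (count-⟦⟧ (s ∷ [])) (≤-pred (≰⇒> |N∩X|<2)))
    Y-false : ∀ {z} → z ≢ s → nbrs u X z ≡ false → Y z ≡ false
    Y-false z≢s n = ∨-false (∉⇒⟦⟧-false (s ∷ []) (∉-single z≢s)) n
    nbrs-irrefl : nbrs u X u ≡ false
    nbrs-irrefl rewrite adj-irr u = refl
    t≢s : t ≢ s
    t≢s refl = K#L t ks lt
    t∉N : nbrs u X t ≡ false
    t∉N rewrite L-avoids lt = ∧-zeroʳ _
    trapped : ∀ {t′} → L t′ ≡ true → Reach G (∁ G Y) u t′ → ⊥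
    trapped lu (here _) = K#L u ku lu
    trapped _ (step {w = w} _ u~w r) with ∨-false⁻ (not-true (reach-start r))
    ... | w∉s , w∉N = ⟦⟧-false⇒∉ (s ∷ []) w∉s (here (only-s w (component-step K-comp ku u~w (nbrs-false {S = X} u~w w∉N)) u~w))

  saturated-end : ∀ {u v vs} → Path K u v vs → u ≢ v → Saturated u vs → HasCycle G K ⊎ 2 ≤ count (nbrs u X)
  saturated-end (single _) u≢v _ = ⊥-elim (u≢v refl)
  saturated-end {u} (cons {w = s} {vs = vs} ku u~s u∉vs p) _ saturated
    with any? (λ w → (K w Bool.≟ true) ×-dec (adj u w Bool.≟ true) ×-dec ¬? (w ≟ s))
  ... | yes (w , kw , u~w , w≢s) = inj₁ (path-cycle closed (adjˡ u~w) (there (path-first q)) (adj⇒≢ (adjˡ u~s)) (w≢s ∘ sym))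
    where
    w∈vs : w ∈ₗ vs
    w∈vs with saturated w kw u~w
    ... | here refl = ⊥-elim (adj⇒≢ u~w refl)
    ... | there w∈vs = w∈vs
    q : Path K s w (proj₁ (prefix p w∈vs))
    q = proj₁ (proj₂ (prefix p w∈vs))
    closed : Path K u w (u ∷ proj₁ (prefix p w∈vs))
    closed = cons ku u~s (λ u∈ → u∉vs (proj₂ (proj₂ (prefix p w∈vs)) u∈)) q
  ... | no none = inj₂ (two-nbrs-in-X ku (All.lookup (path-inside p) (path-first p)) u~s only-s)
    where
    only-s : ∀ w → K w ≡ true → adj u w ≡ true → w ≡ s
    only-s w kw u~w = decidable-stable (w ≟ s) λ w≢s → none (w , kw , u~w , w≢s)

  -- Two pairs of distinct vertices of the three-element set X meet.
  common-nbr-in-X : ∀ {u v} → 2 ≤ count (nbrs u X) → 2 ≤ count (nbrs v X) →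
    ∃ λ x → X x ≡ true × adj u x ≡ true × adj v x ≡ true
  common-nbr-in-X {u} {v} 2≤u 2≤v with count-two (nbrs u X) 2≤u | count-two (nbrs v X) 2≤v
  ... | a , b , a≢b , ua , ub | c , d , c≢d , vc , vd with a ≟ c | a ≟ d | b ≟ c | b ≟ d
  ...   | yes refl | _        | _        | _        = a , ∧-elimʳ ua , ∧-elimˡ ua , ∧-elimˡ vc
  ...   | no _     | yes refl | _        | _        = a , ∧-elimʳ ua , ∧-elimˡ ua , ∧-elimˡ vd
  ...   | no _     | no _     | yes refl | _        = b , ∧-elimʳ ub , ∧-elimˡ ub , ∧-elimˡ vc
  ...   | no _     | no _     | no _     | yes refl = b , ∧-elimʳ ub , ∧-elimˡ ub , ∧-elimˡ vd
  ...   | no a≢c   | no a≢d   | no b≢c   | no b≢d   =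
    ⊥-elim (¬4≤|X| (distinct-four X a b c d a≢b a≢c a≢d b≢c b≢d c≢d
                      (∧-elimʳ ua) (∧-elimʳ ub) (∧-elimʳ vc) (∧-elimʳ vd)))

  saturated-path : 2 ≤ count K → ∃₂ λ u v → ∃ λ vs → Path K u v vs × u ≢ v × Saturated u vs × Saturated v vs
  saturated-path 2≤ with count-two K 2≤
  ... | k₁ , k₂ , k₁≢k₂ , kk₁ , kk₂ with walk⇒path (component-connected K-comp kk₁ kk₂)
  ... | _ , p with extend-fully p k₁≢k₂
  ... | u , us , pu , u≢k₂ , _ , saturated-u with reverse pu
  ... | _ , ru , _ , us⊆rs with extend-fully ru (u≢k₂ ∘ sym)
  ... | v , ws , pv , v≢u , rs⊆ws , saturated-v =
    v , u , ws , pv , v≢u , saturated-v , λ w kw u~w → rs⊆ws (us⊆rs (saturated-u w kw u~w))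

  -- Either end of a saturated path closes a cycle in K, or both ends have two
  -- neighbours in X and a common one closes a cycle through it.
  saturated-path⇒A′-cycle : ∀ {u v vs} → Path K u v vs → u ≢ v → Saturated u vs → Saturated v vs → HasCycle G A′
  saturated-path⇒A′-cycle {u} {v} {vs} p u≢v saturated-u saturated-v =
    close (saturated-end p u≢v saturated-u) (saturated-end p′ (u≢v ∘ sym) λ w kw v~w → vs⊆rs (saturated-v w kw v~w))
    where
    p′ : Path K v u (proj₁ (reverse p))
    p′ = proj₁ (proj₂ (reverse p))
    vs⊆rs : vs ⊆ₗ proj₁ (reverse p)
    vs⊆rs = proj₂ (proj₂ (proj₂ (reverse p)))
    ku : K u ≡ true
    ku = All.lookup (path-inside p) (path-first p)
    kv : K v ≡ true
    kv = All.lookup (path-inside p) (path-last p)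
    through : (∃ λ x → X x ≡ true × adj u x ≡ true × adj v x ≡ true) → HasCycle G A′
    through (x , xx , u~x , v~x) = path-cycle path v~x (there (path-first p)) (X≢ xx (K-avoids ku) ∘ sym) u≢v
      where
      A′x : A′ x ≡ true
      A′x = X⇒A′ xx (distinct-two (nbrs x A) u v u≢v (∧-intro (adjˡ u~x) (∨-introˡ ku)) (∧-intro (adjˡ v~x) (∨-introˡ kv)))
      path : Path A′ x v (x ∷ vs)
      path = cons A′x (adjˡ u~x) (path-avoids p (X⇒¬K xx)) (path-mono (λ z → K⇒A′ {z}) p)
    close : HasCycle G K ⊎ 2 ≤ count (nbrs u X) → HasCycle G K ⊎ 2 ≤ count (nbrs v X) → HasCycle G A′
    close (inj₁ cycle) _ = hasCycle-mono (λ z → K⇒A′ {z}) cycle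
    close (inj₂ _) (inj₁ cycle) = hasCycle-mono (λ z → K⇒A′ {z}) cycle
    close (inj₂ 2≤u) (inj₂ 2≤v) = through (common-nbr-in-X 2≤u 2≤v)

  2≤|K|⇒A′-cycle : 2 ≤ count K → HasCycle G A′
  2≤|K|⇒A′-cycle 2≤ = from-saturated (saturated-path 2≤)
    where
    from-saturated : (∃₂ λ u v → ∃ λ vs → Path K u v vs × u ≢ v × Saturated u vs × Saturated v vs) → HasCycle G A′
    from-saturated (_ , _ , _ , p , u≢v , saturated-u , saturated-v) = saturated-path⇒A′-cycle p u≢v saturated-u saturated-v

  B′-cycle : HasCycle G B′
  B′-cycle = hasCycle-mono (λ z → trans (B′≐B z)) B-cycle

  nontrivial⇒edge-or-|K|≥2 : Nontrivial G A′ B′ → EdgeInX ⊎ 2 ≤ count K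
  nontrivial⇒edge-or-|K|≥2 (A′-cycle , _) = A′-cycle⇒edge-or-|K|≥2 A′-cycle

  edge-or-|K|≥2⇒nontrivial : EdgeInX ⊎ 2 ≤ count K → Nontrivial G A′ B′
  edge-or-|K|≥2⇒nontrivial h = [ edge-in-X⇒A′-cycle , 2≤|K|⇒A′-cycle ] h , B′-cycle

  nontrivial⇔ : Nontrivial G A′ B′ ⇔ (EdgeInX ⊎ 2 ≤ count K)
  nontrivial⇔ = mk⇔ nontrivial⇒edge-or-|K|≥2 edge-or-|K|≥2⇒nontrivial


  K-closed : ∀ {k l} → K k ≡ true → K l ≡ false → ¬ Reach G (∁ G X) k l
  K-closed kk kl r = true≢false (component-closed K-comp kk r) kl

  module Side (C D : VSet G)
    (cover : ∀ v → (C v ∨ D v) ≡ true)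
    (D°-nonempty : ∃ λ d → (_∖_ G D C) d ≡ true)
    (deg-D : ∀ v → (_∩_ G C D) v ≡ true → 2 ≤ nbrsIn G v D)
    (sep≤3 : AtMostThree (InSeparator C D))
    where

    C° D° W : VSet G
    C° = _∖_ G C D
    D° = _∖_ G D C
    W v = D° v ∧ not (X v)

    Sep : Mixed n → Set
    Sep = InSeparator C D

    Touches : Fin n → Mixed n → Set
    Touches d e = ∃ λ p → Reach G W d p × AttachedAt p e

    D°-cases : ∀ {v} → D° v ≡ false → C° v ≡ true ⊎ (_∩_ G C D) v ≡ true
    D°-cases {v} d°v with C v in cv | D v in dv
    ... | true  | true  = inj₂ refl
    ... | true  | false = inj₁ refl
    ... | false | false = ⊥-elim (true≢false (cover v) (∨-false cv dv))

    ¬C⇒D : ∀ {v} → C v ≡ false → D v ≡ true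
    ¬C⇒D {v} cv with D v in dv
    ... | true = refl
    ... | false = ⊥-elim (true≢false (cover v) (∨-false cv dv))

    ¬D⇒C : ∀ {v} → D v ≡ false → C v ≡ true
    ¬D⇒C {v} dv with C v in cv
    ... | true = refl
    ... | false = ⊥-elim (true≢false (cover v) (∨-false cv dv))

    mkD° : ∀ {v} → D v ≡ true → C v ≡ false → D° v ≡ true
    mkD° dv cv = ∧-intro dv (not-false cv)

    mkW : ∀ {v} → D° v ≡ true → X v ≡ false → W v ≡ true
    mkW d°v xv = ∧-intro d°v (not-false xv)

    W-reach : ∀ {u v} → Reach G W u v → Reach G (∁ G X) u v
    W-reach = reach-mono (λ _ → ∧-elimʳ)

    W⇒¬X : ∀ {v} → W v ≡ true → X v ≡ false
    W⇒¬X {v} wv = not-true (∧-elimʳ {D° v} wv)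

    ¬W⇒X : ∀ {v} → D° v ≡ true → W v ≡ false → X v ≡ true
    ¬W⇒X {v} d°v wv with true-or-false (X v)
    ... | inj₁ xv = xv
    ... | inj₂ xv = ⊥-elim (true≢false (mkW d°v xv) wv)

    C⇒¬D° : ∀ {v} → C v ≡ true → D° v ≡ false
    C⇒¬D° {v} cv = trans (cong (λ b → D v ∧ not b) cv) (∧-zeroʳ (D v))

    base-not-D° : ∀ e → Sep e → D° (base e) ≡ false
    base-not-D° (inj₁ v) v∈S = C⇒¬D° (∧-elimˡ v∈S)
    base-not-D° (inj₂ (a , b)) e∈ = C⇒¬D° (∧-elimˡ (∧-elimˡ e∈))

    leave-D° : ∀ {p w} → D° p ≡ true → D° w ≡ false → adj p w ≡ true →
      ∃ λ e → Sep e × base e ≡ w × AttachedAt p e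
    leave-D° {p} {w} d°p d°w p~w with D°-cases d°w
    ... | inj₁ c°w = inj₂ (w , p) , ∧-intro c°w (∧-intro (adjˡ p~w) d°p) , refl , refl
    ... | inj₂ w∈S = inj₁ w , w∈S , refl , p~w

    touches⇒reach : ∀ {d} e → Sep e → Touches d e → X (base e) ≡ false → Reach G (∁ G X) d (base e)
    touches⇒reach (inj₁ v) _ (p , r , p~v) xv = reach-snoc (W-reach r) p~v (not-false xv)
    touches⇒reach (inj₂ (a , b)) e∈ (p , r , refl) xa =
      reach-snoc (W-reach r) (adjˡ (∧-elimˡ (∧-elimʳ {C° a} e∈))) (not-false xa)

    touches⇒in-region : ∀ {Q d} → IsComponent G X Q → ∀ e → Sep e → Touches d e → InRegion Q e → Q d ≡ true
    touches⇒in-region Q-comp (inj₁ v) _ (p , r , p~v) qv =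
      component-closed Q-comp (component-step Q-comp qv (adjˡ p~v) (W⇒¬X (reach-end r))) (reach-sym (W-reach r))
    touches⇒in-region Q-comp (inj₂ (a , b)) _ (p , r , refl) (inj₂ qb) =
      component-closed Q-comp qb (reach-sym (W-reach r))
    touches⇒in-region Q-comp (inj₂ (a , b)) e∈ (p , r , refl) (inj₁ qa) =
      component-closed Q-comp (component-step Q-comp qa (∧-elimˡ (∧-elimʳ {C° a} e∈)) (W⇒¬X (reach-end r)))
                       (reach-sym (W-reach r))

    unreachable-from : ∀ {d} → X d ≡ false → ∃ λ t → X t ≡ false × ¬ Reach G (∁ G X) d t
    unreachable-from {d} xd with K d in kd | component-nonempty L-comp | component-nonempty K-comp
    ... | true  | t , lt | _ = t , L-avoids lt , λ r → K#L t (component-closed K-comp kd r) lt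
    ... | false | _ | t , kt = t , K-avoids kt , λ r → true≢false (component-closed K-comp kt (reach-sym r)) kd

    -- A path from d to t avoiding the listed vertices leaves W through the separator.
    touched-outside : ∀ {d t} (l : List (Fin n)) → length l ≤ 2 → W d ≡ true → ¬ d ∈ₗ l →
      (∀ z → X z ≡ true → D° z ≡ true → z ∈ₗ l) → X t ≡ false → ¬ t ∈ₗ l → ¬ Reach G (∁ G X) d t →
      ∃ λ e → Sep e × Touches d e × ¬ base e ∈ₗ l
    touched-outside {d} {t} l |l|≤2 wd d∉l X∩D°⊆l xt t∉l unreachable
      with reach-exit {W = W} (connected-after-deleting-two ⟦ l ⟧ (≤-trans (count-⟦⟧ l) |l|≤2)
                                 (∉⇒⟦⟧-false l d∉l) (∉⇒⟦⟧-false l t∉l)) wd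
    ... | inj₁ r = ⊥-elim (unreachable (reach-mono (λ z wz → not-false (W⇒¬X (∧-elimˡ wz))) r))
    ... | inj₂ (p , w , r , p~w , w∉l , ww) with true-or-false (D° w)
    ...   | inj₁ d°w = ⊥-elim (⟦⟧-false⇒∉ l (not-true w∉l) (X∩D°⊆l w (¬W⇒X d°w ww) d°w))
    ...   | inj₂ d°w with leave-D° (∧-elimˡ (∧-elimˡ (reach-end r))) d°w p~w
    ...     | e , e∈ , refl , attached =
      e , e∈ , (p , reach-mono (λ _ → ∧-elimˡ) r , attached) , ⟦⟧-false⇒∉ l (not-true w∉l)

    record TouchedTriple (d : Fin n) : Set where
      constructor triple
      field
        e₁ e₂ e₃   : Mixed n
        distinct   : Unique (e₁ ∷ e₂ ∷ e₃ ∷ [])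
        separating : All Sep (e₁ ∷ e₂ ∷ e₃ ∷ [])
        touched    : All (Touches d) (e₁ ∷ e₂ ∷ e₃ ∷ [])

    triple-exhausts : ∀ {d} → TouchedTriple d → ∀ e → Sep e → Touches d e
    triple-exhausts (triple e₁ e₂ e₃ distinct separating touched) e e∈ =
      All.lookup touched (three-exhaust sep≤3 e₁ e₂ e₃ distinct separating e e∈)

    W≢base : ∀ {d} e → W d ≡ true → Sep e → d ≢ base e
    W≢base e wd e∈ refl = true≢false (∧-elimˡ wd) (base-not-D° e e∈)

    unreachable≢base : ∀ {d t} e → X t ≡ false → ¬ Reach G (∁ G X) d t → Sep e → Touches d e → t ≢ base e
    unreachable≢base e xt unreachable e∈ touch refl = unreachable (touches⇒reach e e∈ touch xt)

    base≢⇒≢ : ∀ {e e′} → base e ≢ base e′ → e ≢ e′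
    base≢⇒≢ b≢b′ refl = b≢b′ refl

    D-cases : ∀ {v} → D v ≡ true → D° v ≡ true ⊎ (_∩_ G C D) v ≡ true
    D-cases {v} dv with true-or-false (D° v)
    ... | inj₁ d°v = inj₁ d°v
    ... | inj₂ d°v with D°-cases d°v
    ...   | inj₁ c°v = ⊥-elim (true≢false dv (not-true (∧-elimʳ {C v} c°v)))
    ...   | inj₂ v∈S = inj₂ v∈S

    regions-disjoint : ∀ {Q Q′} → IsComponent G X Q → IsComponent G X Q′ → Disjoint Q Q′ →
      ∀ e → Sep e → InRegion Q e → InRegion Q′ e → ⊥
    regions-disjoint _ _ Q#Q′ (inj₁ v) _ qv q′v = Q#Q′ v qv q′v
    regions-disjoint _ _ Q#Q′ (inj₂ (a , b)) _ (inj₁ qa) (inj₁ q′a) = Q#Q′ a qa q′a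
    regions-disjoint _ _ Q#Q′ (inj₂ (a , b)) _ (inj₂ qb) (inj₂ q′b) = Q#Q′ b qb q′b
    regions-disjoint Q-comp Q′-comp Q#Q′ (inj₂ (a , b)) e∈ (inj₁ qa) (inj₂ q′b) =
      Q#Q′ b (component-step Q-comp qa (∧-elimˡ (∧-elimʳ {C° a} e∈)) (component-avoids Q′-comp q′b)) q′b
    regions-disjoint Q-comp Q′-comp Q#Q′ (inj₂ (a , b)) e∈ (inj₂ qb) (inj₁ q′a) =
      Q#Q′ b qb (component-step Q′-comp q′a (∧-elimˡ (∧-elimʳ {C° a} e∈)) (component-avoids Q-comp qb))

    module NoXInD° (X∩D°=∅ : ∀ z → X z ≡ true → D° z ≡ true → ⊥) where

      vacuous : ∀ {l} z → X z ≡ true → D° z ≡ true → z ∈ₗ l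
      vacuous z xz d°z = ⊥-elim (X∩D°=∅ z xz d°z)

      D°⇒¬X : ∀ {v} → D° v ≡ true → X v ≡ false
      D°⇒¬X {v} d°v with true-or-false (X v)
      ... | inj₁ xv = ⊥-elim (X∩D°=∅ v xv d°v)
      ... | inj₂ xv = xv

      X⇒C : ∀ {v} → X v ≡ true → C v ≡ true
      X⇒C {v} xv with true-or-false (D° v)
      ... | inj₁ d°v = ⊥-elim (X∩D°=∅ v xv d°v)
      ... | inj₂ d°v with D°-cases d°v
      ...   | inj₁ c°v = ∧-elimˡ c°v
      ...   | inj₂ v∈S = ∧-elimˡ v∈S

      -- Paths from d to another component, each avoiding the bases found before, cross the
      -- separator three times.
      touched-three : ∀ {d} → W d ≡ true → TouchedTriple d
      touched-three {d} wd with unreachable-from (W⇒¬X wd)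
      ... | t , xt , unreachable
        with touched-outside [] z≤n wd (λ ()) vacuous xt (λ ()) unreachable
      ... | e₁ , s₁ , t₁ , _
        with touched-outside (base e₁ ∷ []) (s≤s z≤n) wd (∉-single (W≢base e₁ wd s₁)) vacuous xt
               (∉-single (unreachable≢base e₁ xt unreachable s₁ t₁)) unreachable
      ... | e₂ , s₂ , t₂ , b₂∉
        with touched-outside (base e₁ ∷ base e₂ ∷ []) (s≤s (s≤s z≤n)) wd
               (∉-pair (W≢base e₁ wd s₁) (W≢base e₂ wd s₂)) vacuous xt
               (∉-pair (unreachable≢base e₁ xt unreachable s₁ t₁) (unreachable≢base e₂ xt unreachable s₂ t₂))
               unreachable
      ... | e₃ , s₃ , t₃ , b₃∉ =
        triple e₁ e₂ e₃ ((e₁≢e₂ ∷ e₁≢e₃ ∷ []) ∷ (e₂≢e₃ ∷ []) ∷ [] ∷ []) (s₁ ∷ s₂ ∷ s₃ ∷ []) (t₁ ∷ t₂ ∷ t₃ ∷ [])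
        where
        e₁≢e₂ : e₁ ≢ e₂
        e₁≢e₂ = base≢⇒≢ (λ b₁≡b₂ → b₂∉ (here (sym b₁≡b₂)))
        e₁≢e₃ : e₁ ≢ e₃
        e₁≢e₃ = base≢⇒≢ (λ b₁≡b₃ → b₃∉ (here (sym b₁≡b₃)))
        e₂≢e₃ : e₂ ≢ e₃
        e₂≢e₃ = base≢⇒≢ (λ b₂≡b₃ → b₃∉ (there (here (sym b₂≡b₃))))

      touches-all : ∀ {d} → W d ≡ true → ∀ e → Sep e → Touches d e
      touches-all wd = triple-exhausts (touched-three wd)

      separator-vertex-reached : ∀ {d v} → W d ≡ true → C v ≡ true → D v ≡ true → X v ≡ false → Reach G (∁ G X) d v
      separator-vertex-reached {v = v} wd cv dv xv = touches⇒reach (inj₁ v) v∈S (touches-all wd (inj₁ v) v∈S) xv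
        where
        v∈S : (_∩_ G C D) v ≡ true
        v∈S = ∧-intro cv dv

      IsXVertex : Mixed n → Set
      IsXVertex e = ∃ λ w → e ≡ inj₁ w × X w ≡ true

      IsXVertex⇒X : ∀ {e} → IsXVertex e → X (base e) ≡ true
      IsXVertex⇒X (_ , refl , xw) = xw

      -- k and l would be joined in G − X through any other separator element both touch.
      separator-in-X : ∀ {k l} → K k ≡ true → K l ≡ false → W k ≡ true → W l ≡ true → ∀ e → Sep e → IsXVertex e
      separator-in-X kk kl wk wl (inj₁ w) w∈S with true-or-false (X w)
      ... | inj₁ xw = w , refl , xw
      ... | inj₂ xw = ⊥-elim (K-closed kk kl (reach-trans (reached wk) (reach-sym (reached wl))))
        where
        reached : ∀ {d} → W d ≡ true → Reach G (∁ G X) d w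
        reached wd = touches⇒reach (inj₁ w) w∈S (touches-all wd (inj₁ w) w∈S) xw
      separator-in-X {k} {l} kk kl wk wl (inj₂ (a , b)) e∈ =
        ⊥-elim (joined (touches-all wk (inj₂ (a , b)) e∈) (touches-all wl (inj₂ (a , b)) e∈))
        where
        joined : Touches k (inj₂ (a , b)) → Touches l (inj₂ (a , b)) → ⊥
        joined (_ , r , refl) (_ , r′ , refl) = K-closed kk kl (reach-trans (W-reach r) (reach-sym (W-reach r′)))

      K∩C-empty : ∀ {k l} → K k ≡ true → K l ≡ false → W k ≡ true → W l ≡ true → ∀ v → K v ≡ true → C v ≡ true → ⊥
      K∩C-empty {k} kk kl wk wl v kv cv with D v in dv
      ... | true = true≢false (IsXVertex⇒X (separator-in-X kk kl wk wl (inj₁ v) (∧-intro cv dv))) (K-avoids kv)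
      ... | false with reach-exit {W = D°} (component-connected K-comp kk kv) (∧-elimˡ wk)
      ...   | inj₁ r = true≢false (∧-elimˡ (∧-elimˡ (reach-end r))) dv
      ...   | inj₂ (p , w , r , p~w , kw , d°w) with leave-D° (∧-elimˡ (reach-end r)) d°w p~w
      ...     | e , e∈ , refl , _ = true≢false (IsXVertex⇒X (separator-in-X kk kl wk wl e e∈)) (K-avoids kw)

      X⊆D : ∀ {d} → TouchedTriple d → (∀ e → Sep e → IsXVertex e) → ∀ v → X v ≡ true → D v ≡ true
      X⊆D (triple e₁ e₂ e₃ ((n₁₂ ∷ n₁₃ ∷ []) ∷ (n₂₃ ∷ []) ∷ [] ∷ []) (s₁ ∷ s₂ ∷ s₃ ∷ []) _) in-X v xv
        with in-X e₁ s₁ | in-X e₂ s₂ | in-X e₃ s₃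
      ... | w₁ , refl , x₁ | w₂ , refl , x₂ | w₃ , refl , x₃ with v ≟ w₁ | v ≟ w₂ | v ≟ w₃
      ...   | yes refl | _        | _        = ∧-elimʳ s₁
      ...   | no _     | yes refl | _        = ∧-elimʳ s₂
      ...   | no _     | no _     | yes refl = ∧-elimʳ s₃
      ...   | no v≢w₁  | no v≢w₂  | no v≢w₃  =
        ⊥-elim (¬4≤|X| (distinct-four X v w₁ w₂ w₃ v≢w₁ v≢w₂ v≢w₃
                          (n₁₂ ∘ cong inj₁) (n₁₃ ∘ cong inj₁) (n₂₃ ∘ cong inj₁) xv x₁ x₂ x₃))

      split-K-case : ∀ {k l} → K k ≡ true → K l ≡ false → W k ≡ true → W l ≡ true → _≼_ G (A′ , B′) (D , C)
      split-K-case kk kl wk wl = A′⊆D , C⊆B′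
        where
        A′⊆D : ∀ v → A′ v ≡ true → D v ≡ true
        A′⊆D v a′v with A′-cases a′v
        ... | inj₂ (xv , _) = X⊆D (touched-three wk) (separator-in-X kk kl wk wl) v xv
        ... | inj₁ kv with true-or-false (C v)
        ...   | inj₁ cv = ⊥-elim (K∩C-empty kk kl wk wl v kv cv)
        ...   | inj₂ cv = ¬C⇒D cv
        C⊆B′ : ∀ v → C v ≡ true → B′ v ≡ true
        C⊆B′ v cv with true-or-false (K v)
        ... | inj₁ kv = ⊥-elim (K∩C-empty kk kl wk wl v kv cv)
        ... | inj₂ kv = ¬K⇒B′ kv

      outside-vertex-case : ∀ {k l} → K k ≡ true → D k ≡ true → K l ≡ false → X l ≡ false → D l ≡ true →
        _≼_ G (A′ , B′) (D , C)
      outside-vertex-case {k} {l} kk dk kl xl dl with true-or-false (C k) | true-or-false (C l)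
      ... | inj₂ ck | inj₂ cl = split-K-case kk kl (mkW (mkD° dk ck) (K-avoids kk)) (mkW (mkD° dl cl) xl)
      ... | inj₁ ck | inj₂ cl = ⊥-elim (K-closed kk kl (reach-sym (separator-vertex-reached (mkW (mkD° dl cl) xl) ck dk (K-avoids kk))))
      ... | inj₂ ck | inj₁ cl = ⊥-elim (K-closed kk kl (separator-vertex-reached (mkW (mkD° dk ck) (K-avoids kk)) cl dl xl))
      ... | inj₁ ck | inj₁ cl =
        ⊥-elim (K-closed kk kl (reach-trans (reach-sym (separator-vertex-reached wd ck dk (K-avoids kk)))
                                            (separator-vertex-reached wd cl dl xl)))
        where
        wd : W (proj₁ D°-nonempty) ≡ true
        wd = mkW (proj₂ D°-nonempty) (D°⇒¬X (proj₂ D°-nonempty))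

      K∩D-empty-case : (∀ k → K k ≡ true → D k ≡ true → ⊥) → _≼_ G (A′ , B′) (C , D)
      K∩D-empty-case K∩D=∅ = A′⊆C , D⊆B′
        where
        A′⊆C : ∀ v → A′ v ≡ true → C v ≡ true
        A′⊆C v a′v with A′-cases a′v
        ... | inj₂ (xv , _) = X⇒C xv
        ... | inj₁ kv with true-or-false (D v)
        ...   | inj₁ dv = ⊥-elim (K∩D=∅ v kv dv)
        ...   | inj₂ dv = ¬D⇒C dv
        D⊆B′ : ∀ v → D v ≡ true → B′ v ≡ true
        D⊆B′ v dv with true-or-false (K v)
        ... | inj₁ kv = ⊥-elim (K∩D=∅ v kv dv)
        ... | inj₂ kv = ¬K⇒B′ kv

      D⊆K∪X-case : (∀ l → K l ≡ false → X l ≡ false → D l ≡ true → ⊥) → _≼_ G (B′ , A′) (C , D)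
      D⊆K∪X-case D⊆K∪X = B′⊆C , D⊆A′
        where
        B′⊆C : ∀ v → B′ v ≡ true → C v ≡ true
        B′⊆C v b′v with true-or-false (X v) | true-or-false (D v)
        ... | inj₁ xv | _       = X⇒C xv
        ... | inj₂ xv | inj₁ dv = ⊥-elim (D⊆K∪X v (B′⇒¬K b′v) xv dv)
        ... | inj₂ xv | inj₂ dv = ¬D⇒C dv
        D-nbrs⊆A : ∀ v u → nbrs v D u ≡ true → nbrs v A u ≡ true
        D-nbrs⊆A v u vu with true-or-false (K u) | true-or-false (X u)
        ... | inj₁ ku | _       = ∧-intro (∧-elimˡ vu) (∨-introˡ ku)
        ... | inj₂ ku | inj₁ xu = ∧-intro (∧-elimˡ vu) (∨-introʳ {K u} xu)
        ... | inj₂ ku | inj₂ xu = ⊥-elim (D⊆K∪X u ku xu (∧-elimʳ {adj v u} vu))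
        D⊆A′ : ∀ v → D v ≡ true → A′ v ≡ true
        D⊆A′ v dv with true-or-false (K v) | true-or-false (X v)
        ... | inj₁ kv | _       = K⇒A′ kv
        ... | inj₂ kv | inj₁ xv = X⇒A′ xv (≤-trans (deg-D v (∧-intro (X⇒C xv) dv)) (count-mono (D-nbrs⊆A v)))
        ... | inj₂ kv | inj₂ xv = ⊥-elim (D⊆K∪X v kv xv dv)

      nested : _≼_ G (A′ , B′) (C , D) ⊎ _≼_ G (A′ , B′) (D , C) ⊎ _≼_ G (B′ , A′) (C , D)
      nested with any? (λ k → (K k Bool.≟ true) ×-dec (D k Bool.≟ true))
      ... | no K∩D=∅ = inj₁ (K∩D-empty-case λ k kk dk → K∩D=∅ (k , kk , dk))
      ... | yes (k , kk , dk) with any? (λ l → (K l Bool.≟ false) ×-dec (X l Bool.≟ false) ×-dec (D l Bool.≟ true))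
      ...   | yes (l , kl , xl , dl) = inj₂ (inj₁ (outside-vertex-case kk dk kl xl dl))
      ...   | no D⊆K∪X = inj₂ (inj₂ (D⊆K∪X-case λ l kl xl dl → D⊆K∪X (l , kl , xl , dl)))

    module OneXInD° {x y : Fin n} (xx : X x ≡ true) (c°x : C° x ≡ true) (xy : X y ≡ true) (d°y : D° y ≡ true)
                    (X∩D°⊆y : ∀ z → X z ≡ true → D° z ≡ true → z ≡ y) where

      -- x and y both have neighbours in every component; walking between them inside the
      -- component crosses the separator.
      element-in-region : ∀ {Q Q′} → IsComponent G X Q → IsComponent G X Q′ → Disjoint Q Q′ →
        ∃ λ e → Sep e × InRegion Q e
      element-in-region Q-comp Q′-comp Q#Q′ with attaches xx Q-comp Q′-comp Q#Q′ | attaches xy Q-comp Q′-comp Q#Q′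
      ... | a , qa , x~a | b , qb , y~b with true-or-false (D° b)
      ...   | inj₂ d°b with leave-D° d°y d°b y~b
      ...     | e , e∈ , refl , _ = e , e∈ , base-in-region e qb
      element-in-region Q-comp Q′-comp Q#Q′ | a , qa , x~a | b , qb , y~b | inj₁ d°b
        with reach-exit {W = D°} (component-connected Q-comp qb qa) d°b
      ... | inj₁ r = inj₂ (x , a) , ∧-intro c°x (∧-intro x~a (∧-elimˡ (reach-end r))) , inj₂ qa
      ... | inj₂ (p , w , r , p~w , qw , d°w) with leave-D° (∧-elimˡ (reach-end r)) d°w p~w
      ...   | e , e∈ , refl , _ = e , e∈ , base-in-region e qw

      element-of : ∀ i → ∃ λ e → Sep e × InRegion (component i) e
      element-of i = element-in-region (component-is i) (component-is (proj₁ (another i)))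
                                       (components-disjoint (proj₂ (another i)))

      element : Fin 3 → Mixed n
      element i = proj₁ (element-of i)

      element-sep : ∀ i → Sep (element i)
      element-sep i = proj₁ (proj₂ (element-of i))

      element-region : ∀ i → InRegion (component i) (element i)
      element-region i = proj₂ (proj₂ (element-of i))

      in-two-regions : ∀ {i j} → i ≢ j → ∀ e → Sep e → InRegion (component i) e → InRegion (component j) e → ⊥
      in-two-regions {i} {j} i≢j = regions-disjoint (component-is i) (component-is j) (components-disjoint i≢j)

      element-injective : ∀ {i j} → element i ≡ element j → i ≡ j
      element-injective {i} {j} eq = decidable-stable (i ≟ j) λ i≢j →
        in-two-regions i≢j (element i) (element-sep i) (element-region i)
                       (subst (InRegion (component j)) (sym eq) (element-region j))

      elements : List (Mixed n)
      elements = element zero ∷ element (suc zero) ∷ element (suc (suc zero)) ∷ []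

      elements-distinct : Unique elements
      elements-distinct = ((λ e → 0≢1 (element-injective e)) ∷ (λ e → 0≢2 (element-injective e)) ∷ [])
                        ∷ ((λ e → 1≢2 (element-injective e)) ∷ []) ∷ [] ∷ []
        where
        0≢1 : zero ≢ suc {2} zero
        0≢1 ()
        0≢2 : zero ≢ suc {2} (suc zero)
        0≢2 ()
        1≢2 : suc zero ≢ suc {2} (suc zero)
        1≢2 ()

      Located : Mixed n → Set
      Located e = ∃ λ i → e ≡ element i

      listed⇒located : ∀ {e} → e ∈ₗ elements → Located e
      listed⇒located (here e≡) = zero , e≡
      listed⇒located (there (here e≡)) = suc zero , e≡
      listed⇒located (there (there (here e≡))) = suc (suc zero) , e≡

      locate : ∀ e → Sep e → Located e
      locate e e∈ = listed⇒located
        (three-exhaust sep≤3 _ _ _ elements-distinct (element-sep _ ∷ element-sep _ ∷ element-sep _ ∷ []) e e∈)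

      located-region : ∀ {e} i → e ≡ element i → InRegion (component i) e
      located-region i refl = element-region i

      located-in-region⇒element : ∀ {e} i → Sep e → InRegion (component i) e → Located e → e ≡ element i
      located-in-region⇒element i e∈ in-i (j , e≡) = trans e≡ (cong element (sym i≡j))
        where
        i≡j : i ≡ j
        i≡j = decidable-stable (i ≟ j) λ i≢j → in-two-regions i≢j _ e∈ in-i (located-region j e≡)

      in-region⇒element : ∀ i e → Sep e → InRegion (component i) e → e ≡ element i
      in-region⇒element i e e∈ in-i = located-in-region⇒element i e∈ in-i (locate e e∈)

      touched-located-unique : ∀ {d e e′} → Sep e → Touches d e → Sep e′ → Touches d e′ → Located e → Located e′ → e ≡ e′
      touched-located-unique {d} e∈ t e′∈ t′ (i , e≡) (j , e′≡) = trans e≡ (trans (cong element i≡j) (sym e′≡))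
        where
        i≡j : i ≡ j
        i≡j = decidable-stable (i ≟ j) λ i≢j →
          components-disjoint i≢j d (touches⇒in-region (component-is i) _ e∈ t (located-region i e≡))
                                    (touches⇒in-region (component-is j) _ e′∈ t′ (located-region j e′≡))

      touched-unique : ∀ {d e e′} → Sep e → Touches d e → Sep e′ → Touches d e′ → e ≡ e′
      touched-unique e∈ t e′∈ t′ = touched-located-unique e∈ t e′∈ t′ (locate _ e∈) (locate _ e′∈)

      X∩D°-listed : ∀ {l} z → X z ≡ true → D° z ≡ true → z ∈ₗ y ∷ l
      X∩D°-listed z xz d°z = here (X∩D°⊆y z xz d°z)

      -- A vertex of W would touch two distinct separator elements, both in the region of its component.
      W-empty : ∀ d → W d ≡ true → ⊥
      W-empty d wd with unreachable-from (W⇒¬X wd)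
      ... | t , xt , unreachable
        with touched-outside (y ∷ []) (s≤s z≤n) wd (∉-single (X≢ xy (W⇒¬X wd) ∘ sym)) X∩D°-listed xt
               (∉-single (X≢ xy xt ∘ sym)) unreachable
      ... | e₁ , s₁ , t₁ , _
        with touched-outside (y ∷ base e₁ ∷ []) (s≤s (s≤s z≤n)) wd (∉-pair (X≢ xy (W⇒¬X wd) ∘ sym) (W≢base e₁ wd s₁))
               X∩D°-listed xt
               (∉-pair (X≢ xy xt ∘ sym) (unreachable≢base e₁ xt unreachable s₁ t₁)) unreachable
      ... | e₂ , s₂ , t₂ , b₂∉ = base≢⇒≢ (λ b₁≡b₂ → b₂∉ (there (here (sym b₁≡b₂)))) (touched-unique s₁ t₁ s₂ t₂)

      D°≡y : ∀ {v} → D° v ≡ true → v ≡ y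
      D°≡y {v} d°v with true-or-false (X v)
      ... | inj₁ xv = X∩D°⊆y v xv d°v
      ... | inj₂ xv = ⊥-elim (W-empty v (mkW d°v xv))

      region-of : ∀ e → Sep e → ∃ λ i → InRegion (component i) e
      region-of e e∈ = proj₁ (locate e e∈) , located-region _ (proj₂ (locate e e∈))

      -- Adjacent separator vertices would lie in the same component, hence be the same element.
      adjacent-separator-vertices : ∀ {s a} → (_∩_ G C D) s ≡ true → (_∩_ G C D) a ≡ true → adj s a ≡ true → ⊥
      adjacent-separator-vertices {s} {a} s∈S a∈S s~a = same-component (region-of (inj₁ s) s∈S) (region-of (inj₁ a) a∈S)
        where
        same-component : (∃ λ i → component i s ≡ true) → (∃ λ j → component j a ≡ true) → ⊥
        same-component (i , s∈i) (j , a∈j) =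
          adj⇒≢ s~a (sym (inj₁-injective (trans (in-region⇒element i (inj₁ a) a∈S a∈i) (sym (in-region⇒element i (inj₁ s) s∈S s∈i)))))
          where
          a∈i : component i a ≡ true
          a∈i = component-step (component-is i) s∈i s~a (component-avoids (component-is j) a∈j)

      S-empty : ∀ v → (_∩_ G C D) v ≡ true → ⊥
      S-empty s s∈S with count-two (nbrs s D) (deg-D s s∈S)
      ... | a , b , a≢b , sa , sb = a≢b (trans (nbr≡y sa) (sym (nbr≡y sb)))
        where
        nbr≡y : ∀ {a} → nbrs s D a ≡ true → a ≡ y
        nbr≡y {a} sa with D-cases (∧-elimʳ {adj s a} sa)
        ... | inj₁ d°a = D°≡y d°a
        ... | inj₂ a∈S = ⊥-elim (adjacent-separator-vertices s∈S a∈S (∧-elimˡ sa))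

      -- Two neighbours of y in A give two edges of the separator in the region of K.
      y∉A′ : A′ y ≡ true → ⊥
      y∉A′ a′y with A′-cases a′y
      ... | inj₁ ky = true≢false xy (K-avoids ky)
      ... | inj₂ (_ , 2≤) with count-two (nbrs y A) 2≤
      ...   | a , b , a≢b , ya , yb = a≢b (,-injectiveˡ (inj₂-injective (trans (edge≡ ya) (sym (edge≡ yb)))))
        where
        edge≡ : ∀ {a} → nbrs y A a ≡ true → inj₂ (a , y) ≡ element zero
        edge≡ {a} ya with true-or-false (D° a)
        ... | inj₁ d°a = ⊥-elim (adj⇒≢ (∧-elimˡ ya) (sym (D°≡y d°a)))
        ... | inj₂ d°a with D°-cases d°a
        ...   | inj₂ a∈S = ⊥-elim (S-empty a a∈S)
        ...   | inj₁ c°a = in-region⇒element zero _ e∈ (in-K (∨-elim (∧-elimʳ {adj y a} ya)))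
          where
          e∈ : Sep (inj₂ (a , y))
          e∈ = ∧-intro c°a (∧-intro (adjˡ (∧-elimˡ ya)) d°y)
          in-K : K a ≡ true ⊎ X a ≡ true → InRegion K (inj₂ (a , y))
          in-K (inj₁ ka) = inj₁ ka
          in-K (inj₂ xa) = ⊥-elim (inside-X (region-of _ e∈))
            where
            inside-X : (∃ λ i → InRegion (component i) (inj₂ (a , y))) → ⊥
            inside-X (i , inj₁ a∈i) = true≢false xa (component-avoids (component-is i) a∈i)
            inside-X (i , inj₂ y∈i) = true≢false xy (component-avoids (component-is i) y∈i)

      nested : _≼_ G (A′ , B′) (C , D)
      nested = A′⊆C , D⊆B′
        where
        A′⊆C : ∀ v → A′ v ≡ true → C v ≡ true
        A′⊆C v a′v with true-or-false (C v)
        ... | inj₁ cv = cv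
        ... | inj₂ cv = ⊥-elim (y∉A′ (subst (λ z → A′ z ≡ true) (D°≡y (mkD° (¬C⇒D cv) cv)) a′v))
        D⊆B′ : ∀ v → D v ≡ true → B′ v ≡ true
        D⊆B′ v dv with D-cases dv
        ... | inj₂ v∈S = ⊥-elim (S-empty v v∈S)
        ... | inj₁ d°v rewrite D°≡y d°v = ¬K⇒B′ (X⇒¬K xy)

  module Nesting (C D : VSet G)
    (cover : ∀ v → (C v ∨ D v) ≡ true)
    (C°-nonempty : ∃ λ c → (_∖_ G C D) c ≡ true) (D°-nonempty : ∃ λ d → (_∖_ G D C) d ≡ true)
    (|sep|≡3 : separatorSize G C D ≡ 3)
    (deg : ∀ v → (_∩_ G C D) v ≡ true → 2 ≤ nbrsIn G v C × 2 ≤ nbrsIn G v D)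
    where

    sep≤3 : AtMostThree (InSeparator C D)
    sep≤3 = separator-at-most-three C D |sep|≡3

    module CD = Side C D cover D°-nonempty (λ v v∈ → proj₂ (deg v v∈)) sep≤3
    module DC = Side D C (λ v → trans (∨-comm (D v) (C v)) (cover v)) C°-nonempty
                         (λ v v∈ → proj₁ (deg v (trans (∧-comm (C v) (D v)) v∈))) (at-most-three-flip C D sep≤3)

    Comparable : Set
    Comparable = _≼_ G (A′ , B′) (C , D) ⊎ _≼_ G (A′ , B′) (D , C) ⊎ _≼_ G (B′ , A′) (C , D) ⊎ _≼_ G (B′ , A′) (D , C)

    from-CD : _≼_ G (A′ , B′) (C , D) ⊎ _≼_ G (A′ , B′) (D , C) ⊎ _≼_ G (B′ , A′) (C , D) → Comparable
    from-CD (inj₁ p) = inj₁ p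
    from-CD (inj₂ (inj₁ p)) = inj₂ (inj₁ p)
    from-CD (inj₂ (inj₂ p)) = inj₂ (inj₂ (inj₁ p))

    from-DC : _≼_ G (A′ , B′) (D , C) ⊎ _≼_ G (A′ , B′) (C , D) ⊎ _≼_ G (B′ , A′) (D , C) → Comparable
    from-DC (inj₁ p) = inj₂ (inj₁ p)
    from-DC (inj₂ (inj₁ p)) = inj₁ p
    from-DC (inj₂ (inj₂ p)) = inj₂ (inj₂ (inj₂ p))

    C°≢D° : ∀ {a b} → (_∖_ G C D) a ≡ true → (_∖_ G D C) b ≡ true → a ≢ b
    C°≢D° c°a d°b refl = true≢false (∧-elimˡ c°a) (not-true (∧-elimʳ {D _} d°b))

    -- Either one side of (C , D) misses X, or X meets C ∖ D and D ∖ C and one of them in a single vertex.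
    comparable : Comparable
    comparable with any? (λ z → (X z Bool.≟ true) ×-dec ((_∖_ G D C) z Bool.≟ true))
    ... | no X∩D°=∅ = from-CD (CD.NoXInD°.nested λ z xz d°z → X∩D°=∅ (z , xz , d°z))
    ... | yes (y , xy , d°y) with any? (λ z → (X z Bool.≟ true) ×-dec ((_∖_ G C D) z Bool.≟ true))
    ...   | no X∩C°=∅ = from-DC (DC.NoXInD°.nested λ z xz c°z → X∩C°=∅ (z , xz , c°z))
    ...   | yes (x , xx , c°x)
      with any? (λ z → (X z Bool.≟ true) ×-dec ((_∖_ G D C) z Bool.≟ true) ×-dec ¬? (z ≟ y))
    ...     | no only-y = inj₁ (CD.OneXInD°.nested xx c°x xy d°y λ z xz d°z →
                                  decidable-stable (z ≟ y) λ z≢y → only-y (z , xz , d°z , z≢y))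
    ...     | yes (y′ , xy′ , d°y′ , y′≢y)
      with any? (λ z → (X z Bool.≟ true) ×-dec ((_∖_ G C D) z Bool.≟ true) ×-dec ¬? (z ≟ x))
    ...       | no only-x = inj₂ (inj₁ (DC.OneXInD°.nested xy d°y xx c°x λ z xz c°z →
                                          decidable-stable (z ≟ x) λ z≢x → only-x (z , xz , c°z , z≢x)))
    ...       | yes (x′ , xx′ , c°x′ , x′≢x) =
      ⊥-elim (¬4≤|X| (distinct-four X x x′ y y′ (x′≢x ∘ sym) (C°≢D° c°x d°y) (C°≢D° c°x d°y′)
                                    (C°≢D° c°x′ d°y) (C°≢D° c°x′ d°y′) (y′≢y ∘ sym) xx xx′ xy xy′))

  totally-nested : TotallyNested G A′ B′
  totally-nested C D (((cover , C°-nonempty , D°-nonempty) , |sep|≡3) , deg) =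
    Nesting.comparable C D cover C°-nonempty D°-nonempty |sep|≡3 deg

mainTheorem15 : (G : Graph) → ThreeConnected G →
    (X : VSet G) → count X ≡ 3 → AtLeastThreeComponents G X →
    (K : VSet G) → IsComponent G X K →
    let A  = λ v → K v ∨ X v
        B  = λ v → not (K v)
        A′ = proj₁ (reduction G A B)
        B′ = proj₂ (reduction G A B)
    in (_≐_ G B′ B × _≼_ G (A′ , B′) (A , B))
     × (HalfConnected G A′ B′ × Strong G A′ B′)
     × (Nontrivial G A′ B′ → TotallyNested G A′ B′)
     × (Nontrivial G A′ B′ ⇔
         ((∃ λ x → ∃ λ y → _∈_ G x X × _∈_ G y X × Graph.adj G x y ≡ true)
          ⊎ 2 ≤ count K))
-- Part (3) holds without its nontriviality hypothesis.
mainTheorem15 G three-connected X |X|≡3 three-components K K-comp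
  with Walks.Components.two-other-components G K-comp three-components
... | L , M , L-comp , M-comp , K#L , K#M , L#M =
  reduction-≼ , (reduction-half-connected , reduction-strong) , (λ _ → totally-nested) , nontrivial⇔
  where open Configuration G three-connected X |X|≡3 K L M K-comp L-comp M-comp K#L K#M L#M
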